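{- Let $G$ be a finite connected loopless multigraph containing the complete graph $K_4$ as a minor, and suppose $G$ is endowed with a ribbon structure such that this $K_4$ minor, with the ribbon structure induced from $G$, is a nonplanar ribbon graph. Then $G$ admits a proper witness pair.
   Context: A ribbon structure on a finite connected loopless multigraph $G$ (parallel edges allowed) is a choice, for each vertex $v$, of a cyclic ordering of the edges incident to $v$; a graph with a ribbon structure is a ribbon graph. A ribbon structure induces a natural ribbon structure on every minor (deleting an edge removes it from the cyclic orders; contracting an edge merges the cyclic orders at its two endpoints in the natural way, i.e. as in the corresponding embedded surface). For edges $e_0,e_1$ at $v$ write $e_0\prec e_1$ if $e_1$ immediately succeeds $e_0$ in the cyclic order at $v$, and let the interval $[e_0,e_1]$ be the set $\{e_0,f_1,\dots,f_k,e_1\}$ where $e_0\prec f_1\prec\cdots\prec f_k\prec e_1$. A path in $G$ is the image of a map from a path graph into $G$ that is injective on edges (not necessarily on vertices); a cycle is the image of a map from a cycle graph injective on both vertices and edges. If $C$ is a cycle with an orientation, each vertex $v$ of $C$ has an incoming edge $e_{\mathrm{in}}$ and outgoing edge $e_{\mathrm{out}}$ in $C$; an edge $e$ at $v$ is to the left of $C$ if $e\in[e_{\mathrm{out}},e_{\mathrm{in}}]$ and to the right if $e\in[e_{\mathrm{in}},e_{\mathrm{out}}]$. A cycle $C$ is nonseparating if for any orientation of $C$ there is a path $P$ meeting $C$ only in the endpoints of $P$, whose first edge is to the left of $C$ and whose last edge is to the right of $C$; $P$ is a witness for $C$ and $(C,P)$ a witness pair. A ribbon graph is nonplanar if it contains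 a nonseparating cycle. A witness pair $(C,P)$ is proper if the two endpoints of $P$ are distinct vertices of $C$. -}

module Defs where

open import Data.Nat using (ℕ; zero; suc; _<_)
open import Data.Fin using (Fin; punchIn; punchOut; _≟_)
open import Data.Bool using (Bool; true; false; not)
open import Data.Product using (Σ; ∃; ∃₂; _×_; _,_; proj₁; proj₂)
open import Data.Sum using (_⊎_)
open import Data.List using (List; []; _∷_; _++_; map; reverse)
open import Data.List.Membership.Propositional using (_∈_; _∉_)
open import Data.List.Relation.Unary.Unique.Propositional using (Unique)
open import Relation.Binary.PropositionalEquality using (_≡_; _≢_; sym)
open import Relation.Nullary using (yes; no)
open import Function.Definitions using (Injective)

-- A multigraph with vertex set Fin n and edge set Fin m; each edge e has
-- two darts (e , false) and (e , true); `end d` is the vertex at which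
-- dart d sits.  The edge of dart (e , b) joins end (e , b) and
-- end (e , not b).  The ribbon structure is the rotation σ : dart ↦ the
-- dart immediately succeeding it in the cyclic order at its vertex.

Dart : ℕ → Set
Dart m = Fin m × Bool

flip : ∀ {m} → Dart m → Dart m
flip (e , b) = (e , not b)

record RData (n m : ℕ) : Set where
  field
    end : Dart m → Fin n
    σ   : Dart m → Dart m
open RData public

iter : ∀ {A : Set} → (A → A) → ℕ → A → A
iter f zero    x = x
iter f (suc k) x = f (iter f k x)

IsRibbon : ∀ {n m} → RData n m → Set
IsRibbon R =
  Injective _≡_ _≡_ (σ R)
  × (∀ d → end R (σ R d) ≡ end R d)
  × (∀ d d' → end R d ≡ end R d' → ∃ λ k → iter (σ R) k d ≡ d')

Loopless : ∀ {n m} → RData n m → Set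
Loopless R = ∀ e → end R (e , false) ≢ end R (e , true)

IsWalk : ∀ {n m} → RData n m → Fin n → Fin n → List (Dart m) → Set
IsWalk R x y []       = x ≡ y
IsWalk R x y (d ∷ ds) = end R d ≡ x × IsWalk R (end R (flip d)) y ds

Connected : ∀ {n m} → RData n m → Set
Connected R = ∀ x y → ∃ λ ds → IsWalk R x y ds

-- deleting edge e: the successor of a dart skips the darts of e
delete : ∀ {n m} → RData n (suc m) → Fin (suc m) → RData n m
delete {n} {m} R e = record { end = end' ; σ = σ' }
  where
  end' : Dart m → Fin n
  end' (f , b) = end R (punchIn e f , b)
  skip : ℕ → Dart m → Dart (suc m) → Dart m
  skip zero    dflt y = dflt
  skip (suc k) dflt y with e ≟ proj₁ y
  ... | yes _ = skip k dflt (σ R y)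
  ... | no p  = (punchOut p , proj₂ y)
  σ' : Dart m → Dart m
  σ' (f , b) = skip 3 (f , b) (σ R (punchIn e f , b))

collapse : ∀ {n} (u v : Fin (suc n)) → u ≢ v → Fin (suc n) → Fin n
collapse u v u≢v w with v ≟ w
... | yes _ = punchOut {i = v} {j = u} (λ eq → u≢v (sym eq))
... | no p  = punchOut p

-- contracting the non-loop edge e with endpoints u = end (e,false) and
-- v = end (e,true): the cyclic order at the merged vertex is
-- (order at u starting after e) followed by (order at v starting after e),
-- as in the embedded surface.
contract : ∀ {n m} (R : RData (suc n) (suc m)) (e : Fin (suc m)) →
           end R (e , false) ≢ end R (e , true) → RData n m
contract {n} {m} R e nl = record { end = end' ; σ = σ' }
  where
  end' : Dart m → Fin n
  end' (f , b) = collapse (end R (e , false)) (end R (e , true)) nl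
                          (end R (punchIn e f , b))
  jump : ℕ → Dart m → Dart (suc m) → Dart m
  jump zero    dflt y = dflt
  jump (suc k) dflt y with e ≟ proj₁ y
  ... | yes _ = jump k dflt (σ R (flip y))
  ... | no p  = (punchOut p , proj₂ y)
  σ' : Dart m → Dart m
  σ' (f , b) = jump 3 (f , b) (σ R (punchIn e f , b))

removeVertex : ∀ {n m} (R : RData (suc n) m) (w : Fin (suc n)) →
               (∀ d → w ≢ end R d) → RData n m
removeVertex R w iso = record { end = λ d → punchOut (iso d) ; σ = σ R }

data Minor : ∀ {n m n' m'} → RData n m → RData n' m' → Set where
  done   : ∀ {n m} {G : RData n m} → Minor G G
  del    : ∀ {n m n' m'} {G : RData n (suc m)} {H : RData n' m'}
             (e : Fin (suc m)) → Minor (delete G e) H → Minor G H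
  con    : ∀ {n m n' m'} {G : RData (suc n) (suc m)} {H : RData n' m'}
             (e : Fin (suc m)) (nl : end G (e , false) ≢ end G (e , true)) →
             Minor (contract G e nl) H → Minor G H
  delV   : ∀ {n m n' m'} {G : RData (suc n) m} {H : RData n' m'}
             (w : Fin (suc n)) (iso : ∀ d → w ≢ end G d) →
             Minor (removeVertex G w iso) H → Minor G H

Joins : ∀ {n m} → RData n m → Fin m → Fin n → Fin n → Set
Joins R e i j = (end R (e , false) ≡ i × end R (e , true) ≡ j)
              ⊎ (end R (e , false) ≡ j × end R (e , true) ≡ i)

IsK4 : ∀ {m} → RData 4 m → Set
IsK4 R = Loopless R
       × (∀ e e' i j → Joins R e i j → Joins R e' i j → e ≡ e')
       × (∀ i j → i ≢ j → ∃ λ e → Joins R e i j)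

IsCycle : ∀ {n m} → RData n m → List (Dart m) → Set
IsCycle R cs = (cs ≢ []) × (∃ λ x → IsWalk R x x cs)
             × Unique (map proj₁ cs) × Unique (map (end R) cs)

-- b cyclically follows a in cs
Consec : ∀ {A : Set} → List A → A → A → Set
Consec cs a b = ∃₂ λ xs ys → xs ++ a ∷ b ∷ ys ≡ cs ++ cs

-- x ∈ [d0 , d1] in the cyclic order
Interval : ∀ {n m} → RData n m → Dart m → Dart m → Dart m → Set
Interval R d0 d1 x = ∃ λ k → iter (σ R) k d0 ≡ x
                             × (∀ j → j < k → iter (σ R) j d0 ≢ d1)

-- at the vertex end b of the cycle, the incoming dart is flip a and the
-- outgoing dart is b (a, b consecutive darts of the cycle)
LeftOf : ∀ {n m} → RData n m → List (Dart m) → Dart m → Set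
LeftOf R cs x = ∃₂ λ a b → Consec cs a b × end R b ≡ end R x
                         × Interval R b (flip a) x

RightOf : ∀ {n m} → RData n m → List (Dart m) → Dart m → Set
RightOf R cs x = ∃₂ λ a b → Consec cs a b × end R b ≡ end R x
                          × Interval R (flip a) b x

lastD : ∀ {A : Set} → A → List A → A
lastD d []       = d
lastD d (x ∷ xs) = lastD x xs

Witness : ∀ {n m} → RData n m → List (Dart m) → Fin n → Fin n →
          Dart m → List (Dart m) → Set
Witness R cs x y d ds =
    IsWalk R x y (d ∷ ds)
  × Unique (map proj₁ (d ∷ ds))
  × x ∈ map (end R) cs × y ∈ map (end R) cs
  × (∀ f → f ∈ d ∷ ds → proj₁ f ∉ map proj₁ cs)
  × (∀ f → f ∈ d ∷ ds → end R f ∈ map (end R) cs → end R f ≡ x ⊎ end R f ≡ y)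
  × LeftOf R cs d
  × RightOf R cs (flip (lastD d ds))

HasWitness : ∀ {n m} → RData n m → List (Dart m) → Set
HasWitness R cs = ∃₂ λ x y → ∃₂ λ d ds → Witness R cs x y d ds

Nonseparating : ∀ {n m} → RData n m → List (Dart m) → Set
Nonseparating R cs = HasWitness R cs × HasWitness R (reverse (map flip cs))

Nonplanar : ∀ {n m} → RData n m → Set
Nonplanar R = ∃ λ cs → IsCycle R cs × Nonseparating R cs

ProperWitnessPair : ∀ {n m} → RData n m → Set
ProperWitnessPair R = ∃ λ cs → ∃₂ λ x y → ∃₂ λ d ds →
  IsCycle R cs × Witness R cs x y d ds × x ≢ y

-- A witness pair is strong if its path meets the cycle only in its two end vertices, which are distinct;
-- a strong witness pair is proper. In K4 every witness pair is strong: an inner vertex of the path on the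
-- cycle, or a path that closes up on itself, would give some vertex two cycle edges and two path edges,
-- hence four distinct neighbours. Strong witness pairs lift from a minor back to the graph, one minor
-- operation at a time. Deleting an edge or an isolated vertex only adds darts, and the intervals of the
-- rotations only grow. Contracting an edge e to a vertex w is undone by re-inserting e into the cycle or
-- the path where they pass through w; whether and where e is needed is read off from how the rotation at
-- w splits into the rotations at the two ends of e.

module Submission where

open import Defs
open import Data.Nat using (ℕ; zero; suc; _<_; _≤_; s≤s; s≤s⁻¹; _+_; _∸_; _*_)
open import Data.Nat.Properties
  using (≤-refl; ≤-trans; n<1+n; <-trans; +-suc; m∸n+n≡m; m∸n≤m; m+n∸n≡m; ≰⇒>; ≮⇒≥; ≤∧≢⇒<; ∸-monoˡ-<)
open import Data.Nat.DivMod using (_%_; _/_; m≡m%n+[m/n]*n; m%n<n)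
import Data.Nat as ℕ
open import Data.Fin using (Fin; punchIn; punchOut; _≟_) renaming (zero to fz)
open import Data.Fin.Properties
  using (punchIn-punchOut; punchInᵢ≢i; punchIn-injective; punchOut-injective; punchOut-cong)
open import Data.Bool using (Bool; true; false; not)
open import Data.Bool.Properties using (not-involutive)
open import Data.Product using (Σ; ∃; ∃₂; _×_; _,_; proj₁; proj₂)
open import Data.Sum using (_⊎_; inj₁; inj₂)
import Data.Sum as Sum
open import Data.Empty using (⊥; ⊥-elim)
open import Data.List using (List; []; _∷_; _++_; map; [_])
open import Data.List.Properties using (++-assoc; map-++; ∷-injective; ++-identityʳ)
open import Data.List.Membership.Propositional using (_∈_; _∉_)
open import Data.List.Membership.Propositional.Properties
  using (∈-map⁺; ∈-map⁻; ∈-++⁺ˡ; ∈-++⁺ʳ; ∈-++⁻; ∈-∃++)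
open import Data.List.Relation.Unary.Any using (here; there)
open import Data.List.Relation.Unary.All as All using (All; []; _∷_)
import Data.List.Relation.Unary.All.Properties as Allₚ
import Data.List.Relation.Unary.AllPairs as AllPairs
import Data.List.Relation.Unary.AllPairs.Properties as AllPairsₚ
open import Data.List.Relation.Unary.AllPairs using ([]; _∷_)
open import Data.List.Relation.Unary.Unique.Propositional using (Unique)
open import Relation.Binary.PropositionalEquality hiding ([_])
open import Relation.Nullary using (¬_; yes; no; Dec)

flip-involutive : ∀ {m} (d : Dart m) → flip (flip d) ≡ d
flip-involutive (e , b) = cong (e ,_) (not-involutive b)

module _ {A : Set} where

  data Adjacent (cs : List A) (a b : A) : Set where
    inner : ∀ xs ys → xs ++ a ∷ b ∷ ys ≡ cs → Adjacent cs a b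
    wrap  : ∀ xs ys → cs ≡ b ∷ ys → cs ≡ xs ++ [ a ] → Adjacent cs a b

  ++-≡-split : ∀ (xs zs cs ds : List A) → xs ++ zs ≡ cs ++ ds →
    (∃ λ k → xs ≡ cs ++ k × ds ≡ k ++ zs) ⊎ (∃ λ k → cs ≡ xs ++ k × zs ≡ k ++ ds)
  ++-≡-split [] zs cs ds eq = inj₂ (cs , refl , eq)
  ++-≡-split (x ∷ xs) zs [] ds eq = inj₁ (x ∷ xs , refl , sym eq)
  ++-≡-split (x ∷ xs) zs (c ∷ cs) ds eq with ∷-injective eq
  ... | refl , eq′ = Sum.map (λ (k , p , q) → k , cong (x ∷_) p , q)
                              (λ (k , p , q) → k , cong (x ∷_) p , q)
                              (++-≡-split xs zs cs ds eq′)

  Adjacent⇒Consec : ∀ {cs a b} → Adjacent cs a b → Consec cs a b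
  Adjacent⇒Consec {cs} {a} {b} (inner xs ys eq) =
    xs , ys ++ cs , trans (sym (++-assoc xs (a ∷ b ∷ ys) cs)) (cong (_++ cs) eq)
  Adjacent⇒Consec {cs} {a} {b} (wrap xs ys eq₁ eq₂) =
    xs , ys , sym (trans (cong₂ _++_ eq₂ eq₁) (++-assoc xs [ a ] (b ∷ ys)))

  -- Consec looks for the pair in cs ++ cs; it either lies in one copy or straddles the seam.
  Consec⇒Adjacent : ∀ {cs a b} → Consec cs a b → Adjacent cs a b
  Consec⇒Adjacent {cs} {a} {b} (xs , ys , eq) with ++-≡-split xs (a ∷ b ∷ ys) cs cs eq
  ... | inj₁ (k , _ , q) = inner k ys (sym q)
  ... | inj₂ ([] , _ , q) = inner [] ys q
  ... | inj₂ (_ ∷ [] , p , refl) = wrap xs ys refl p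
  ... | inj₂ (_ ∷ _ ∷ k , p , refl) = inner xs k (sym p)

  Adjacent-∈ : ∀ {cs a b} → Adjacent cs a b → a ∈ cs × b ∈ cs
  Adjacent-∈ (inner xs ys refl) = ∈-++⁺ʳ xs (here refl) , ∈-++⁺ʳ xs (there (here refl))
  Adjacent-∈ {a = a} (wrap xs ys refl eq) = subst (a ∈_) (sym eq) (∈-++⁺ʳ xs (here refl)) , here refl

  Adjacent-rotate : ∀ {x xs a b} → Adjacent (x ∷ xs) a b → Adjacent (xs ++ [ x ]) a b
  Adjacent-rotate (inner [] zs eq) with ∷-injective eq
  ... | refl , refl = wrap (_ ∷ zs) (zs ++ [ _ ]) refl refl
  Adjacent-rotate {x} (inner (y ∷ ys) zs eq) with ∷-injective eq
  ... | refl , refl = inner ys (zs ++ [ x ]) (sym (++-assoc ys (_ ∷ _ ∷ zs) [ x ]))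
  Adjacent-rotate (wrap xs ys eq₁ eq₂) with ∷-injective eq₁
  Adjacent-rotate (wrap [] ys eq₁ refl) | refl , refl = wrap [] [] refl refl
  Adjacent-rotate {x} (wrap (_ ∷ xs) ys eq₁ eq₂) | refl , refl with ∷-injective eq₂
  ... | refl , refl = inner xs [] (sym (++-assoc xs _ [ x ]))

  lastD-++ : ∀ (d : A) xs q ys → lastD d (xs ++ q ∷ ys) ≡ lastD q ys
  lastD-++ d [] q ys = refl
  lastD-++ d (x ∷ xs) q ys = lastD-++ x xs q ys

  lastD-∈ : ∀ (d : A) ds → lastD d ds ∈ d ∷ ds
  lastD-∈ d [] = here refl
  lastD-∈ d (d′ ∷ ds) = there (lastD-∈ d′ ds)

  lastD-snoc : ∀ {c a : A} bs xs → c ∷ bs ≡ xs ++ [ a ] → lastD c bs ≡ a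
  lastD-snoc [] [] refl = refl
  lastD-snoc [] (_ ∷ []) ()
  lastD-snoc [] (_ ∷ _ ∷ _) ()
  lastD-snoc (b ∷ bs) [] ()
  lastD-snoc (b ∷ bs) (x ∷ xs) eq with ∷-injective eq
  ... | refl , eq′ = lastD-snoc bs xs eq′

  ∷-as-snoc : ∀ (c : A) bs → ∃ λ ps → c ∷ bs ≡ ps ++ [ lastD c bs ]
  ∷-as-snoc c [] = [] , refl
  ∷-as-snoc c (b ∷ bs) with ∷-as-snoc b bs
  ... | ps , eq = c ∷ ps , cong (c ∷_) eq

  ∈-predecessor : ∀ {f : A} d ds → f ∈ ds → ∃₂ λ ps qs → ∃ λ f₀ → d ∷ ds ≡ ps ++ f₀ ∷ f ∷ qs
  ∈-predecessor d (d′ ∷ ds) (here refl) = [] , ds , d , refl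
  ∈-predecessor d (d′ ∷ ds) (there f∈) with ∈-predecessor d′ ds f∈
  ... | ps , qs , f₀ , eq = d ∷ ps , qs , f₀ , cong (d ∷_) eq

  ∈-rotate : ∀ {z a : A} {ys} → z ∈ a ∷ ys → z ∈ ys ++ [ a ]
  ∈-rotate {ys = ys} (here p) = ∈-++⁺ʳ ys (here p)
  ∈-rotate (there z∈) = ∈-++⁺ˡ z∈

  ∈-rotate⁻ : ∀ {z a : A} {ys} → z ∈ ys ++ [ a ] → z ∈ a ∷ ys
  ∈-rotate⁻ {ys = ys} z∈ with ∈-++⁻ ys z∈
  ... | inj₁ p = there p
  ... | inj₂ (here p) = here p

  ∈-insert : ∀ {f : A} ps ms ss → f ∈ ps ++ ss → f ∈ ps ++ ms ++ ss
  ∈-insert ps ms ss f∈ with ∈-++⁻ ps f∈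
  ... | inj₁ p = ∈-++⁺ˡ p
  ... | inj₂ p = ∈-++⁺ʳ ps (∈-++⁺ʳ ms p)

Unique-snoc : ∀ {A : Set} {ys : List A} {a} → Unique ys → All (a ≢_) ys → Unique (ys ++ [ a ])
Unique-snoc [] [] = [] ∷ []
Unique-snoc (py ∷ u) (na ∷ nas) = Allₚ.++⁺ py ((λ q → na (sym q)) ∷ []) ∷ Unique-snoc u nas

module _ {A B : Set} (g : A → B) where

  Unique-map-injective : ∀ {xs a b} → Unique (map g xs) → a ∈ xs → b ∈ xs → g a ≡ g b → a ≡ b
  Unique-map-injective {x ∷ xs} (_ ∷ u) (here refl) (here refl) eq = refl
  Unique-map-injective {x ∷ xs} (px ∷ u) (here refl) (there b∈) eq = ⊥-elim (All.lookup px (∈-map⁺ g b∈) eq)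
  Unique-map-injective {x ∷ xs} (px ∷ u) (there a∈) (here refl) eq = ⊥-elim (All.lookup px (∈-map⁺ g a∈) (sym eq))
  Unique-map-injective {x ∷ xs} (_ ∷ u) (there a∈) (there b∈) eq = Unique-map-injective u a∈ b∈ eq

  Unique-map-∷ : ∀ a {b} xs → Unique (map g (a ∷ xs)) → b ∈ xs → g a ≢ g b
  Unique-map-∷ a xs (px ∷ _) b∈ = All.lookup px (∈-map⁺ g b∈)

  Unique-map-consecutive : ∀ ps a b qs → Unique (map g (ps ++ a ∷ b ∷ qs)) → g a ≢ g b
  Unique-map-consecutive [] a b qs ((p ∷ _) ∷ _) = p
  Unique-map-consecutive (_ ∷ ps) a b qs (_ ∷ u) = Unique-map-consecutive ps a b qs u

  Unique-map-rotate : ∀ {a xs} → Unique (map g (a ∷ xs)) → Unique (map g (xs ++ [ a ]))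
  Unique-map-rotate {a} {xs} (pa ∷ u) = subst Unique (sym (map-++ g xs [ a ])) (Unique-snoc u pa)

  Adjacent-head : ∀ {c} cs {a b} → Unique (map g (c ∷ cs)) → Adjacent (c ∷ cs) a b → g b ≡ g c → b ≡ c × a ≡ lastD c cs
  Adjacent-head {c} cs u ad eq with Unique-map-injective u (proj₂ (Adjacent-∈ ad)) (here refl) eq
  Adjacent-head {c} cs u (inner xs ys eq′) eq | refl = ⊥-elim (not-later xs u eq′)
    where
    not-later : ∀ {a ys} xs → Unique (map g (c ∷ cs)) → xs ++ a ∷ c ∷ ys ≢ c ∷ cs
    not-later [] (pc ∷ _) eq with ∷-injective eq
    ... | refl , eq₂ = All.lookup pc (∈-map⁺ g (subst (_ ∈_) eq₂ (here refl))) refl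
    not-later (x ∷ xs) (pc ∷ _) eq with ∷-injective eq
    ... | refl , eq₂ = All.lookup pc (∈-map⁺ g (subst (c ∈_) eq₂ (∈-++⁺ʳ xs (there (here refl))))) refl
  Adjacent-head cs u (wrap xs ys refl eq′) eq | refl = refl , sym (lastD-snoc cs xs eq′)

  Unique-map-remove : ∀ ps ms ss → Unique (map g (ps ++ ms ++ ss)) → Unique (map g (ps ++ ss))
  Unique-map-remove [] [] ss u = u
  Unique-map-remove [] (_ ∷ ms) ss (_ ∷ u) = Unique-map-remove [] ms ss u
  Unique-map-remove (_ ∷ ps) ms ss (a ∷ u) = All-map-remove ps a ∷ Unique-map-remove ps ms ss u
    where
    All-map-remove : ∀ {P : B → Set} ps → All P (map g (ps ++ ms ++ ss)) → All P (map g (ps ++ ss))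
    All-map-remove [] a = Allₚ.map⁺ (Allₚ.++⁻ʳ ms (Allₚ.map⁻ a))
    All-map-remove (_ ∷ ps) (px ∷ a) = px ∷ All-map-remove ps a

Unique-map-reflect : ∀ {A B D : Set} (g : A → B) (h : A → D) → (∀ {a b} → h a ≡ h b → g a ≡ g b) →
                     ∀ {xs} → Unique (map g xs) → Unique (map h xs)
Unique-map-reflect g h t u = AllPairsₚ.map⁺ (AllPairs.map (λ ne eq → ne (t eq)) (AllPairsₚ.map⁻ u))

Unique-map-transfer : ∀ {A B C D : Set} (g : A → B) (h : C → D) (L : A → C) →
                      (∀ {a b} → h (L a) ≡ h (L b) → g a ≡ g b) →
                      ∀ {xs} → Unique (map g xs) → Unique (map h (map L xs))
Unique-map-transfer g h L t u =
  AllPairsₚ.map⁺ (AllPairsₚ.map⁺ (AllPairs.map (λ ne eq → ne (t eq)) (AllPairsₚ.map⁻ u)))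

module _ {A : Set} (f : A → A) where

  iter-suc : ∀ k x → iter f (suc k) x ≡ iter f k (f x)
  iter-suc zero x = refl
  iter-suc (suc k) x = cong f (iter-suc k x)

  iter-+ : ∀ j k x → iter f (j + k) x ≡ iter f j (iter f k x)
  iter-+ zero k x = refl
  iter-+ (suc j) k x = cong f (iter-+ j k x)

  iter-fixed : ∀ {x} → f x ≡ x → ∀ k → iter f k x ≡ x
  iter-fixed fx zero = refl
  iter-fixed fx (suc k) = trans (cong f (iter-fixed fx k)) fx

  Avoid : A → ℕ → A → Set
  Avoid x k X = ∀ j → j < k → iter f j x ≢ X

  Avoid-zero : ∀ {x X} → Avoid x 0 X
  Avoid-zero j ()

  Avoid-suc : ∀ {x X} k → Avoid x k X → iter f k x ≢ X → Avoid x (suc k) X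
  Avoid-suc k av ne j j<1+k with j ℕ.≟ k
  ... | yes refl = ne
  ... | no j≢k = av j (≤∧≢⇒< (s≤s⁻¹ j<1+k) j≢k)

  Avoid-pred : ∀ {x X} k → Avoid x (suc k) X → Avoid x k X
  Avoid-pred k av j j<k = av j (<-trans j<k (n<1+n k))

  iter-compose : ∀ {x y z X} k₁ k₂ → iter f k₁ x ≡ y → Avoid x k₁ X → iter f k₂ y ≡ z → Avoid y k₂ X →
                 iter f (k₂ + k₁) x ≡ z × Avoid x (k₂ + k₁) X
  iter-compose {x} k₁ k₂ r₁ a₁ r₂ a₂ = trans (iter-+ k₂ k₁ x) (trans (cong (iter f k₂) r₁) r₂) , avoid
    where
    avoid : Avoid x (k₂ + k₁) _
    avoid j j< with j ℕ.<? k₁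
    ... | yes j<k₁ = a₁ j j<k₁
    ... | no j≮k₁ = λ eq → a₂ (j ∸ k₁) i<k₂ (begin
          iter f (j ∸ k₁) _              ≡⟨ cong (iter f (j ∸ k₁)) (sym r₁) ⟩
          iter f (j ∸ k₁) (iter f k₁ x)  ≡⟨ sym (iter-+ (j ∸ k₁) k₁ x) ⟩
          iter f (j ∸ k₁ + k₁) x         ≡⟨ cong (λ t → iter f t x) (m∸n+n≡m k₁≤j) ⟩
          iter f j x                     ≡⟨ eq ⟩
          _                              ∎)
      where
      open ≡-Reasoning
      k₁≤j = ≮⇒≥ j≮k₁
      i<k₂ : j ∸ k₁ < k₂
      i<k₂ = subst (j ∸ k₁ <_) (m+n∸n≡m k₂ k₁) (∸-monoˡ-< j< k₁≤j)

  iter-periodic : ∀ {x} p → iter f (suc p) x ≡ x → ∀ k → iter f k x ≡ iter f (k % suc p) x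
  iter-periodic {x} p per k = begin
    iter f k x                                          ≡⟨ cong (λ t → iter f t x) (m≡m%n+[m/n]*n k (suc p)) ⟩
    iter f (k % suc p + (k / suc p) * suc p) x           ≡⟨ iter-+ (k % suc p) _ x ⟩
    iter f (k % suc p) (iter f ((k / suc p) * suc p) x)  ≡⟨ cong (iter f (k % suc p)) (periods (k / suc p)) ⟩
    iter f (k % suc p) x                                ∎
    where
    open ≡-Reasoning
    periods : ∀ q → iter f (q * suc p) x ≡ x
    periods zero = refl
    periods (suc q) = trans (iter-+ (suc p) (q * suc p) x) (trans (cong (iter f (suc p)) (periods q)) per)

  Avoid-periodic : ∀ {x X} p → iter f (suc p) x ≡ x → Avoid x (suc p) X → ∀ k → iter f k x ≢ X
  Avoid-periodic p per av k eq = av (k % suc p) (m%n<n k (suc p)) (trans (sym (iter-periodic p per k)) eq)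

module _ {n m} (R : RData n m) where

  IsWalk-last : ∀ {a b} d ds → IsWalk R a b (d ∷ ds) → end R (flip (lastD d ds)) ≡ b
  IsWalk-last d [] (_ , w) = w
  IsWalk-last d (d′ ∷ ds) (_ , w) = IsWalk-last d′ ds w

  IsWalk-link : ∀ {a b} ps f₀ f qs → IsWalk R a b (ps ++ f₀ ∷ f ∷ qs) → end R (flip f₀) ≡ end R f
  IsWalk-link [] f₀ f qs (_ , (p , _)) = sym p
  IsWalk-link (_ ∷ ps) f₀ f qs (_ , w) = IsWalk-link ps f₀ f qs w

  IsWalk-++ : ∀ {a b c} xs ys → IsWalk R a b xs → IsWalk R b c ys → IsWalk R a c (xs ++ ys)
  IsWalk-++ [] ys refl w₂ = w₂
  IsWalk-++ (x ∷ xs) ys (p , w₁) w₂ = p , IsWalk-++ xs ys w₁ w₂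

  IsWalk-++⁻ : ∀ {a c} xs ys → IsWalk R a c (xs ++ ys) → ∃ λ b → IsWalk R a b xs × IsWalk R b c ys
  IsWalk-++⁻ [] ys w = _ , refl , w
  IsWalk-++⁻ (x ∷ xs) ys (p , w) with IsWalk-++⁻ xs ys w
  ... | b , w₁ , w₂ = b , (p , w₁) , w₂

  IsWalk-predecessor : ∀ {a b} cs c → IsWalk R a b cs → c ∈ cs →
                       end R c ≡ a ⊎ (∃ λ c₀ → c₀ ∈ cs × end R (flip c₀) ≡ end R c)
  IsWalk-predecessor (c₁ ∷ cs) c (p , w) (here refl) = inj₁ p
  IsWalk-predecessor (c₁ ∷ cs) c (p , w) (there c∈) with IsWalk-predecessor cs c w c∈
  ... | inj₁ q = inj₂ (c₁ , here refl , sym q)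
  ... | inj₂ (c₀ , c₀∈ , q) = inj₂ (c₀ , there c₀∈ , q)

  closedWalk-predecessor : ∀ {z} cs → IsWalk R z z cs → ∀ {c} → c ∈ cs →
                          ∃ λ c₀ → c₀ ∈ cs × end R (flip c₀) ≡ end R c
  closedWalk-predecessor cs w {c} c∈ with IsWalk-predecessor cs c w c∈
  closedWalk-predecessor cs w c∈ | inj₂ r = r
  closedWalk-predecessor (c₁ ∷ cs) w c∈ | inj₁ q =
    lastD c₁ cs , lastD-∈ c₁ cs , trans (IsWalk-last c₁ cs w) (sym q)

  closedWalk-Adjacent : ∀ {z cs a b} → IsWalk R z z cs → Adjacent cs a b → end R (flip a) ≡ end R b
  closedWalk-Adjacent w (inner xs ys refl) = IsWalk-link xs _ _ ys w
  closedWalk-Adjacent {a = a} {b} w (wrap xs ys refl eq) =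
    trans (cong (λ t → end R (flip t)) (sym (lastD-snoc ys xs eq))) (trans (IsWalk-last b ys w) (sym (proj₁ w)))

  dart-Joins : ∀ (g : Dart m) → Joins R (proj₁ g) (end R g) (end R (flip g))
  dart-Joins (e , false) = inj₁ (refl , refl)
  dart-Joins (e , true) = inj₂ (refl , refl)

  Loopless-dart : Loopless R → ∀ (g : Dart m) → end R g ≢ end R (flip g)
  Loopless-dart ll (e , false) = ll e
  Loopless-dart ll (e , true) eq = ll e (sym eq)

-- IsRibbon without the injectivity of σ, which the argument never needs.
record IsWeakRibbon {n m} (R : RData n m) : Set where
  field
    end-σ        : ∀ d → end R (σ R d) ≡ end R d
    σ-transitive : ∀ d d′ → end R d ≡ end R d′ → ∃ λ k → iter (σ R) k d ≡ d′

  end-iter : ∀ k d → end R (iter (σ R) k d) ≡ end R d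
  end-iter zero d = refl
  end-iter (suc k) d = trans (end-σ _) (end-iter k d)

IsRibbon⇒IsWeakRibbon : ∀ {n m} {R : RData n m} → IsRibbon R → IsWeakRibbon R
IsRibbon⇒IsWeakRibbon (_ , end-σ , σ-transitive) = record { end-σ = end-σ ; σ-transitive = σ-transitive }

-- Strong witness pairs

LeftOf′ : ∀ {n m} → RData n m → List (Dart m) → Dart m → Set
LeftOf′ R cs x = ∃₂ λ a b → Adjacent cs a b × end R b ≡ end R x × Interval R b (flip a) x

RightOf′ : ∀ {n m} → RData n m → List (Dart m) → Dart m → Set
RightOf′ R cs x = ∃₂ λ a b → Adjacent cs a b × end R b ≡ end R x × Interval R (flip a) b x

record StrongWitness {n m} (R : RData n m) (cs : List (Dart m)) : Set where
  constructor sw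
  field
    source target  : Fin n
    first          : Dart m
    rest           : List (Dart m)
    isWalk         : IsWalk R source target (first ∷ rest)
    edges-distinct : Unique (map proj₁ (first ∷ rest))
    source∈cycle   : source ∈ map (end R) cs
    target∈cycle   : target ∈ map (end R) cs
    edges-off      : ∀ f → f ∈ first ∷ rest → proj₁ f ∉ map proj₁ cs
    interior-off   : ∀ f → f ∈ rest → end R f ∉ map (end R) cs
    leaves-left    : LeftOf′ R cs first
    enters-right   : RightOf′ R cs (flip (lastD first rest))
    source≢target  : source ≢ target

  last : Dart m
  last = lastD first rest

open StrongWitness

StrongWitnessPair : ∀ {n m} → RData n m → Set
StrongWitnessPair {m = m} R = ∃ λ (cs : List (Dart m)) → IsCycle R cs × StrongWitness R cs

StrongWitnessPair⇒ProperWitnessPair : ∀ {n m} {R : RData n m} → StrongWitnessPair R → ProperWitnessPair R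
StrongWitnessPair⇒ProperWitnessPair {R = R}
  (cs , cyc , sw x y d ds wlk upath xin yin disj mid (a , b , ad , eb , iv) (a′ , b′ , ad′ , eb′ , iv′) x≢y) =
  cs , x , y , d , ds , cyc ,
  (wlk , upath , xin , yin , disj , endpoints ,
   (a , b , Adjacent⇒Consec ad , eb , iv) , (a′ , b′ , Adjacent⇒Consec ad′ , eb′ , iv′)) , x≢y
  where
  endpoints : ∀ f → f ∈ d ∷ ds → end R f ∈ map (end R) cs → end R f ≡ x ⊎ end R f ≡ y
  endpoints f (here refl) _ = inj₁ (proj₁ wlk)
  endpoints f (there f∈) e∈ = ⊥-elim (mid f f∈ e∈)

Witness-edges-off : ∀ {n m} {R : RData n m} {cs x y d ds} → Witness R cs x y d ds →
                    ∀ f c → f ∈ d ∷ ds → c ∈ cs → proj₁ c ≢ proj₁ f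
Witness-edges-off {cs = cs} W f c f∈ c∈ eq =
  proj₁ (proj₂ (proj₂ (proj₂ (proj₂ W)))) f f∈ (subst (_∈ map proj₁ cs) eq (∈-map⁺ proj₁ c∈))

module _ {n m} (R : RData n m) where

  StrongWitness-rotate : ∀ {c cs} → IsCycle R (c ∷ cs) → StrongWitness R (c ∷ cs) →
                         IsCycle R (cs ++ [ c ]) × StrongWitness R (cs ++ [ c ])
  StrongWitness-rotate {c} {cs} (_ , (z , (p₀ , w)) , ue , uv)
    (sw x y d ds wlk upath xin yin disj mid (a , b , ad , eb , iv) (a′ , b′ , ad′ , eb′ , iv′) x≢y) =
    (nonempty cs , (_ , IsWalk-++ R cs [ c ] w (p₀ , refl)) , Unique-map-rotate proj₁ ue , Unique-map-rotate (end R) uv) ,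
    sw x y d ds wlk upath (∈-map-rotate xin) (∈-map-rotate yin)
       (λ f f∈ q → disj f f∈ (∈-map-rotate⁻ q)) (λ f f∈ q → mid f f∈ (∈-map-rotate⁻ q))
       (a , b , Adjacent-rotate ad , eb , iv) (a′ , b′ , Adjacent-rotate ad′ , eb′ , iv′) x≢y
    where
    nonempty : ∀ ys → ys ++ [ c ] ≢ []
    nonempty [] ()
    nonempty (_ ∷ _) ()
    ∈-map-rotate : ∀ {B : Set} {g : Dart m → B} {z} → z ∈ map g (c ∷ cs) → z ∈ map g (cs ++ [ c ])
    ∈-map-rotate {g = g} z∈ with ∈-map⁻ g z∈
    ... | _ , c∈ , refl = ∈-map⁺ g (∈-rotate c∈)
    ∈-map-rotate⁻ : ∀ {B : Set} {g : Dart m → B} {z} → z ∈ map g (cs ++ [ c ]) → z ∈ map g (c ∷ cs)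
    ∈-map-rotate⁻ {g = g} z∈ with ∈-map⁻ g z∈
    ... | _ , c∈ , refl = ∈-map⁺ g (∈-rotate⁻ c∈)

  StrongWitnessPair-rotate-++ : ∀ ps qs → IsCycle R (ps ++ qs) → StrongWitness R (ps ++ qs) →
                                Σ (StrongWitnessPair R) λ s → proj₁ s ≡ qs ++ ps
  StrongWitnessPair-rotate-++ [] qs cyc P = (qs , cyc , P) , sym (++-identityʳ qs)
  StrongWitnessPair-rotate-++ (p ∷ ps) qs cyc P with StrongWitness-rotate cyc P
  ... | cyc′ , P′ with StrongWitnessPair-rotate-++ ps (qs ++ [ p ])
                             (subst (IsCycle R) (++-assoc ps qs [ p ]) cyc′)
                             (subst (StrongWitness R) (++-assoc ps qs [ p ]) P′)
  ... | s , eq = s , trans eq (++-assoc qs [ p ] ps)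

  StrongWitnessPair-startAt : ∀ {cs c} → IsCycle R cs → StrongWitness R cs → c ∈ cs →
                              Σ (StrongWitnessPair R) λ s → ∃ λ cs′ → proj₁ s ≡ c ∷ cs′
  StrongWitnessPair-startAt cyc P c∈ with ∈-∃++ c∈
  ... | ps , qs , refl with StrongWitnessPair-rotate-++ ps (_ ∷ qs) cyc P
  ... | s , eq = s , qs ++ ps , eq

  module _ (w : Fin n) where

    Avoids : List (Dart m) → Set
    Avoids xs = ∀ f → f ∈ xs → end R f ≢ w

    VisitsAtMostOnce : List (Dart m) → Set
    VisitsAtMostOnce xs = Avoids xs ⊎ (∃₂ λ ps q → ∃ λ qs → xs ≡ ps ++ q ∷ qs × Avoids ps × Avoids qs × end R q ≡ w)

    first-visit : ∀ xs → Avoids xs ⊎ (∃₂ λ ps q → ∃ λ qs → xs ≡ ps ++ q ∷ qs × Avoids ps × end R q ≡ w)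
    first-visit [] = inj₁ (λ f ())
    first-visit (x ∷ xs) with end R x ≟ w
    ... | yes p = inj₂ ([] , x , xs , refl , (λ f ()) , p)
    ... | no p with first-visit xs
    ... | inj₁ nw = inj₁ λ { f (here refl) → p ; f (there f∈) → nw f f∈ }
    ... | inj₂ (ps , q , qs , refl , nps , eq) =
      inj₂ (x ∷ ps , q , qs , refl , (λ { f (here refl) → p ; f (there f∈) → nps f f∈ }) , eq)

    last-visit : ∀ q qs → end R q ≡ w → ∃₂ λ ps q′ → ∃ λ rs → q ∷ qs ≡ ps ++ q′ ∷ rs × end R q′ ≡ w × Avoids rs
    last-visit q [] eq = [] , q , [] , refl , eq , (λ f ())
    last-visit q (r ∷ qs) eq with end R r ≟ w
    ... | yes p with last-visit r qs p
    ... | ps , q′ , rs , eq′ , w′ , nrs = q ∷ ps , q′ , rs , cong (q ∷_) eq′ , w′ , nrs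
    last-visit q (r ∷ qs) eq | no p with last-visit q qs eq
    ... | [] , q′ , rs , eq′ , w′ , nrs with ∷-injective eq′
    ... | refl , refl = [] , q , r ∷ qs , refl , eq , (λ { f (here refl) → p ; f (there f∈) → nrs f f∈ })
    last-visit q (r ∷ qs) eq | no p | (_ ∷ ps) , q′ , rs , eq′ , w′ , nrs with ∷-injective eq′
    ... | refl , refl = q ∷ r ∷ ps , q′ , rs , refl , w′ , nrs

    StrongWitness-cut : ∀ {cs} (P : StrongWitness R cs) ps ms q qs → rest P ≡ ps ++ ms ++ q ∷ qs → end R q ≡ w →
                        (∀ {p y} → IsWalk R p y (ms ++ q ∷ qs) → p ≡ w) →
                        Σ (StrongWitness R cs) λ P′ → rest P′ ≡ ps ++ q ∷ qs
    StrongWitness-cut (sw x y d _ wlk upath xin yin disj mid lft (a , b , ad , eb , iv) x≢y)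
                      ps ms q qs refl qw starts-at-w =
      sw x y d (ps ++ q ∷ qs) wlk′ (Unique-map-remove proj₁ (d ∷ ps) ms (q ∷ qs) upath) xin yin
         (λ f f∈ → disj f (∈-insert (d ∷ ps) ms (q ∷ qs) f∈)) (λ f f∈ → mid f (∈-insert ps ms (q ∷ qs) f∈)) lft
         (a , b , ad , subst (λ t → end R b ≡ end R (flip t)) same-last eb ,
          subst (λ t → Interval R (flip a) b (flip t)) same-last iv) x≢y , refl
      where
      same-last : lastD d (ps ++ ms ++ q ∷ qs) ≡ lastD d (ps ++ q ∷ qs)
      same-last = trans (cong (lastD d) (sym (++-assoc ps ms (q ∷ qs))))
                        (trans (lastD-++ d (ps ++ ms) q qs) (sym (lastD-++ d ps q qs)))
      wlk′ : IsWalk R x y (d ∷ ps ++ q ∷ qs)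
      wlk′ with IsWalk-++⁻ R (d ∷ ps) (ms ++ q ∷ qs) wlk
      ... | _ , w₁ , w₂ with IsWalk-++⁻ R ms (q ∷ qs) w₂
      ... | _ , _ , w₄ = IsWalk-++ R (d ∷ ps) (q ∷ qs) w₁
                           (subst (λ t → IsWalk R t y (q ∷ qs)) (trans (sym (proj₁ w₄)) (trans qw (sym (starts-at-w w₂)))) w₄)

    StrongWitness-shortcut : ∀ {cs} → StrongWitness R cs → Σ (StrongWitness R cs) λ P → VisitsAtMostOnce (rest P)
    StrongWitness-shortcut P with first-visit (rest P)
    ... | inj₁ nw = P , inj₁ nw
    ... | inj₂ (ps , q₁ , qs₁ , eq , nps , e₁) with last-visit q₁ qs₁ e₁
    ... | ms , q , qs , eq′ , qw , nqs with StrongWitness-cut P ps ms q qs (trans eq (cong (ps ++_) eq′)) qw starts-at-w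
      where
      starts-at-w : ∀ {p y} → IsWalk R p y (ms ++ q ∷ qs) → p ≡ w
      starts-at-w wk = trans (sym (proj₁ (subst (IsWalk R _ _) (sym eq′) wk))) e₁
    ... | P′ , eq″ = P′ , inj₂ (ps , q , qs , eq″ , nps , nqs , qw)

-- The base case: K4

punchOut-≢ : ∀ {k} {p a b : Fin (suc k)} (p≢a : p ≢ a) (p≢b : p ≢ b) → a ≢ b → punchOut p≢a ≢ punchOut p≢b
punchOut-≢ p≢a p≢b a≢b eq = a≢b (punchOut-injective p≢a p≢b eq)

Fin4-no-five-distinct : {p a b c d : Fin 4} → p ≢ a → p ≢ b → p ≢ c → p ≢ d →
                        a ≢ b → a ≢ c → a ≢ d → b ≢ c → b ≢ d → c ≢ d → ⊥
Fin4-no-five-distinct pa pb pc pd ab ac ad bc bd cd =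
  let ab₁ = punchOut-≢ pa pb ab ; ac₁ = punchOut-≢ pa pc ac ; ad₁ = punchOut-≢ pa pd ad
      bc₁ = punchOut-≢ pb pc bc ; bd₁ = punchOut-≢ pb pd bd ; cd₁ = punchOut-≢ pc pd cd
      bc₂ = punchOut-≢ ab₁ ac₁ bc₁ ; bd₂ = punchOut-≢ ab₁ ad₁ bd₁ ; cd₂ = punchOut-≢ ac₁ ad₁ cd₁
  in punchOut-≢ bc₂ bd₂ cd₂ (Fin1-unique _ _)
  where
  Fin1-unique : (a b : Fin 1) → a ≡ b
  Fin1-unique fz fz = refl

module _ {m} (H : RData 4 m) (k4 : IsK4 H) where

  private
    ll = proj₁ k4
    simple = proj₁ (proj₂ k4)

  K4-neighbours-≢ : ∀ {p} (g h : Dart m) → end H g ≡ p → end H h ≡ p → proj₁ g ≢ proj₁ h →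
                    end H (flip g) ≢ end H (flip h)
  K4-neighbours-≢ g h refl gp g≢h eq = g≢h (simple (proj₁ g) (proj₁ h) _ _ (dart-Joins H g)
    (subst (λ z → Joins H (proj₁ h) z (end H (flip g))) gp
           (subst (Joins H (proj₁ h) (end H h)) (sym eq) (dart-Joins H h))))

  -- The four other ends and p itself would be five distinct vertices.
  K4-degree≤3 : ∀ {p} (g₁ g₂ g₃ g₄ : Dart m) → end H g₁ ≡ p → end H g₂ ≡ p → end H g₃ ≡ p → end H g₄ ≡ p →
                proj₁ g₁ ≢ proj₁ g₂ → proj₁ g₁ ≢ proj₁ g₃ → proj₁ g₁ ≢ proj₁ g₄ →
                proj₁ g₂ ≢ proj₁ g₃ → proj₁ g₂ ≢ proj₁ g₄ → proj₁ g₃ ≢ proj₁ g₄ → ⊥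
  K4-degree≤3 g₁ g₂ g₃ g₄ refl e₂ e₃ e₄ n₁₂ n₁₃ n₁₄ n₂₃ n₂₄ n₃₄ =
    Fin4-no-five-distinct
      (Loopless-dart H ll g₁)
      (λ q → Loopless-dart H ll g₂ (trans e₂ q))
      (λ q → Loopless-dart H ll g₃ (trans e₃ q))
      (λ q → Loopless-dart H ll g₄ (trans e₄ q))
      (K4-neighbours-≢ g₁ g₂ refl e₂ n₁₂) (K4-neighbours-≢ g₁ g₃ refl e₃ n₁₃) (K4-neighbours-≢ g₁ g₄ refl e₄ n₁₄)
      (K4-neighbours-≢ g₂ g₃ e₂ e₃ n₂₃) (K4-neighbours-≢ g₂ g₄ e₂ e₄ n₂₄) (K4-neighbours-≢ g₃ g₄ e₃ e₄ n₃₄)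

  module _ (cs : List (Dart m)) (cyc : IsCycle H cs) where

    private
      ue = proj₁ (proj₂ (proj₂ cyc))

    cycle-in-out : ∀ {p} → p ∈ map (end H) cs →
                   ∃₂ λ cₒ cᵢ → cₒ ∈ cs × cᵢ ∈ cs × end H cₒ ≡ p × end H (flip cᵢ) ≡ p × proj₁ cₒ ≢ proj₁ cᵢ
    cycle-in-out p∈ with ∈-map⁻ (end H) p∈
    ... | cₒ , cₒ∈ , refl with closedWalk-predecessor H cs (proj₂ (proj₁ (proj₂ cyc))) cₒ∈
    ... | cᵢ , cᵢ∈ , q = cₒ , cᵢ , cₒ∈ , cᵢ∈ , refl , q , distinct
      where
      distinct : proj₁ cₒ ≢ proj₁ cᵢ
      distinct eq with Unique-map-injective proj₁ ue cₒ∈ cᵢ∈ eq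
      ... | refl = Loopless-dart H ll cₒ (sym q)

    K4-Witness-interior-off : ∀ {x y d ds} → Witness H cs x y d ds → ∀ f → f ∈ ds → end H f ∉ map (end H) cs
    K4-Witness-interior-off {x} {y} {d} {ds} W f f∈ e∈ with cycle-in-out e∈ | ∈-predecessor d ds f∈
    ... | cₒ , cᵢ , cₒ∈ , cᵢ∈ , eₒ , eᵢ , cₒ≢cᵢ | ps , qs , f₀ , eq =
      K4-degree≤3 cₒ (flip cᵢ) f (flip f₀) eₒ eᵢ refl (IsWalk-link H ps f₀ f qs wlk′) cₒ≢cᵢ
        (off f cₒ (there f∈) cₒ∈) (off f₀ cₒ f₀∈ cₒ∈) (off f cᵢ (there f∈) cᵢ∈) (off f₀ cᵢ f₀∈ cᵢ∈)
        (λ e → Unique-map-consecutive proj₁ ps f₀ f qs upath′ (sym e))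
      where
      wlk′ : IsWalk H x y (ps ++ f₀ ∷ f ∷ qs)
      wlk′ = subst (IsWalk H x y) eq (proj₁ W)
      upath′ = subst (λ l → Unique (map proj₁ l)) eq (proj₁ (proj₂ W))
      off = Witness-edges-off W
      f₀∈ : f₀ ∈ d ∷ ds
      f₀∈ = subst (f₀ ∈_) (sym eq) (∈-++⁺ʳ ps (here refl))

    K4-Witness-proper : ∀ {x y d ds} → Witness H cs x y d ds → x ≢ y
    K4-Witness-proper {d = d} {[]} W refl = Loopless-dart H ll d (trans (proj₁ (proj₁ W)) (sym (proj₂ (proj₁ W))))
    K4-Witness-proper {d = d} {d₂ ∷ ds₂} W refl with cycle-in-out (proj₁ (proj₂ (proj₂ W)))
    ... | cₒ , cᵢ , cₒ∈ , cᵢ∈ , eₒ , eᵢ , cₒ≢cᵢ =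
      K4-degree≤3 cₒ (flip cᵢ) d (flip l) eₒ eᵢ (proj₁ (proj₁ W)) (IsWalk-last H d (d₂ ∷ ds₂) (proj₁ W)) cₒ≢cᵢ
        (off d cₒ (here refl) cₒ∈) (off l cₒ (there l∈) cₒ∈) (off d cᵢ (here refl) cᵢ∈) (off l cᵢ (there l∈) cᵢ∈)
        (Unique-map-∷ proj₁ d (d₂ ∷ ds₂) (proj₁ (proj₂ W)) l∈)
      where
      off = Witness-edges-off W
      l = lastD d₂ ds₂
      l∈ : l ∈ d₂ ∷ ds₂
      l∈ = lastD-∈ d₂ ds₂

K4-Nonplanar⇒StrongWitnessPair : ∀ {m} (H : RData 4 m) → IsK4 H → Nonplanar H → StrongWitnessPair H
K4-Nonplanar⇒StrongWitnessPair H k4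
  (cs , cyc , (x , y , d , ds , W@(wlk , upath , xin , yin , disj , _ , (a , b , ad , eb , iv) , (a′ , b′ , ad′ , eb′ , iv′))) , _) =
  cs , cyc , sw x y d ds wlk upath xin yin disj (K4-Witness-interior-off H k4 cs cyc W)
      (a , b , Consec⇒Adjacent ad , eb , iv) (a′ , b′ , Consec⇒Adjacent ad′ , eb′ , iv′)
      (K4-Witness-proper H k4 cs cyc W)

module _ {A C : Set} (L : A → C) where

  lastD-map : ∀ d ds → lastD (L d) (map L ds) ≡ L (lastD d ds)
  lastD-map d [] = refl
  lastD-map d (d′ ∷ ds) = lastD-map d′ ds

  Adjacent-map : ∀ {cs a b} → Adjacent cs a b → Adjacent (map L cs) (L a) (L b)
  Adjacent-map {a = a} {b} (inner xs ys refl) = inner (map L xs) (map L ys) (sym (map-++ L xs (a ∷ b ∷ ys)))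
  Adjacent-map {a = a} (wrap xs ys refl eq) = wrap (map L xs) (map L ys) refl (trans (cong (map L) eq) (map-++ L xs [ a ]))

  ∈-map-∘ : ∀ {D : Set} (h : C → D) {xs a} → a ∈ xs → h (L a) ∈ map h (map L xs)
  ∈-map-∘ h a∈ = ∈-map⁺ h (∈-map⁺ L a∈)

-- The darts of the graph with edge e deleted, seen as darts of the original graph.
liftDart : ∀ {m} → Fin (suc m) → Dart m → Dart (suc m)
liftDart e (f , b) = (punchIn e f , b)

module _ {m} (e : Fin (suc m)) where

  liftDart-injective : ∀ {a b} → liftDart e a ≡ liftDart e b → a ≡ b
  liftDart-injective {f₁ , b₁} {f₂ , b₂} eq =
    cong₂ _,_ (punchIn-injective e f₁ f₂ (cong proj₁ eq)) (cong proj₂ eq)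

  liftDart-≢ : ∀ a → proj₁ (liftDart e a) ≢ e
  liftDart-≢ (f , b) = punchInᵢ≢i e f

  liftDart-punchOut : ∀ {g : Dart (suc m)} (e≢g : e ≢ proj₁ g) → liftDart e (punchOut e≢g , proj₂ g) ≡ g
  liftDart-punchOut e≢g = cong₂ _,_ (punchIn-punchOut e≢g) refl

  Unique-map-liftDart : ∀ {xs} → Unique (map proj₁ xs) → Unique (map proj₁ (map (liftDart e) xs))
  Unique-map-liftDart = Unique-map-transfer proj₁ proj₁ (liftDart e) (punchIn-injective e _ _)

  edge-dart : ∀ (g : Dart (suc m)) → proj₁ g ≡ e → g ≡ (e , proj₂ g)
  edge-dart g refl = refl

-- Deleting an edge

module Deletion {n m} (G : RData n (suc m)) (e : Fin (suc m)) where

  private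
    H = delete G e
    L = liftDart e

  -- delete searches at most three σ G-steps for a dart off e; StaysOnEdge is the case where the search fails.
  Skips : Dart (suc m) → Dart (suc m) → Set
  Skips x y = ∃ λ j → iter (σ G) (suc j) x ≡ y × (∀ i → i < j → proj₁ (iter (σ G) (suc i) x) ≡ e)

  StaysOnEdge : Dart (suc m) → Set
  StaysOnEdge x = proj₁ (σ G x) ≡ e × proj₁ (σ G (σ G x)) ≡ e × proj₁ (σ G (σ G (σ G x))) ≡ e

  delete-σ : ∀ d → Skips (L d) (L (σ H d)) ⊎ (σ H d ≡ d × StaysOnEdge (L d))
  delete-σ (f , b) with e ≟ proj₁ (σ G (punchIn e f , b))
  ... | no p = inj₁ (0 , sym (liftDart-punchOut e p) , λ i ())
  ... | yes p₁ with e ≟ proj₁ (σ G (σ G (punchIn e f , b)))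
  ... | no p = inj₁ (1 , sym (liftDart-punchOut e p) , λ { zero _ → sym p₁ ; (suc i) (s≤s ()) })
  ... | yes p₂ with e ≟ proj₁ (σ G (σ G (σ G (punchIn e f , b))))
  ... | no p = inj₁ (2 , sym (liftDart-punchOut e p) ,
                     λ { zero _ → sym p₁ ; (suc zero) _ → sym p₂ ; (suc (suc i)) (s≤s (s≤s ())) })
  ... | yes p₃ = inj₂ (refl , sym p₁ , sym p₂ , sym p₃)

  Interval-delete : ∀ {b X z} → Interval H b X z → Interval G (L b) (L X) (L z)
  Interval-delete {b} {X} (k , r , av) with lift k av
    where
    lift : ∀ k → Avoid (σ H) b k X → ∃ λ k′ → iter (σ G) k′ (L b) ≡ L (iter (σ H) k b) × Avoid (σ G) (L b) k′ (L X)
    lift zero av = 0 , refl , Avoid-zero (σ G)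
    lift (suc k) av with lift k (Avoid-pred (σ H) k av)
    ... | k′ , r , a with delete-σ (iter (σ H) k b)
    ... | inj₂ (eq , _) = k′ , trans r (cong L (sym eq)) , a
    ... | inj₁ (j , r′ , skipped) = suc j + k′ , iter-compose (σ G) k′ (suc j) r a r′ a′
      where
      a′ : Avoid (σ G) (L (iter (σ H) k b)) (suc j) (L X)
      a′ zero lt eq = av k (n<1+n k) (liftDart-injective e eq)
      a′ (suc i) (s≤s lt) eq = liftDart-≢ e X (trans (cong proj₁ (sym eq)) (skipped i lt))
  ... | k′ , r′ , a′ = k′ , trans r′ (cong L r) , a′

  module _ (wr : IsWeakRibbon G) where

    open IsWeakRibbon wr

    -- Three σ-steps inside the two darts of e would cycle there forever, yet L d is in the orbit.
    ¬StaysOnEdge : ∀ d → ¬ StaysOnEdge (L d)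
    ¬StaysOnEdge d (f₁ , f₂ , f₃) with σ-transitive (σ G (L d)) (L d) (end-σ (L d))
    ... | k , r = liftDart-≢ e d (trans (cong proj₁ (sym r)) (on-edge k))
      where
      y₁ = σ G (L d)
      y₂ = σ G y₁
      y₃ = σ G y₂
      e₁ = edge-dart e y₁ f₁
      e₂ = edge-dart e y₂ f₂
      e₃ = edge-dart e y₃ f₃
      two-darts : ∀ b₁ b₂ b₃ → σ G (e , b₁) ≡ (e , b₂) → σ G (e , b₂) ≡ (e , b₃) →
                  (e , b₃) ≡ (e , b₁) ⊎ (e , b₃) ≡ (e , b₂)
      two-darts true true b₃ s₂ s₃ = inj₂ (trans (sym s₃) s₂)
      two-darts false false b₃ s₂ s₃ = inj₂ (trans (sym s₃) s₂)
      two-darts true false true s₂ s₃ = inj₁ refl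
      two-darts true false false s₂ s₃ = inj₂ refl
      two-darts false true false s₂ s₃ = inj₁ refl
      two-darts false true true s₂ s₃ = inj₂ refl
      y₃∈ : y₃ ≡ y₁ ⊎ y₃ ≡ y₂
      y₃∈ = Sum.map (λ q → trans e₃ (trans q (sym e₁))) (λ q → trans e₃ (trans q (sym e₂)))
              (two-darts (proj₂ y₁) (proj₂ y₂) (proj₂ y₃) (trans (cong (σ G) (sym e₁)) e₂) (trans (cong (σ G) (sym e₂)) e₃))
      closed : ∀ k → iter (σ G) k y₁ ≡ y₁ ⊎ iter (σ G) k y₁ ≡ y₂
      closed zero = inj₁ refl
      closed (suc k) with closed k
      ... | inj₁ q = inj₂ (cong (σ G) q)
      ... | inj₂ q = Sum.map (trans (cong (σ G) q)) (trans (cong (σ G) q)) y₃∈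
      on-edge : ∀ k → proj₁ (iter (σ G) k y₁) ≡ e
      on-edge k with closed k
      ... | inj₁ q = trans (cong proj₁ q) f₁
      ... | inj₂ q = trans (cong proj₁ q) f₂

    delete-IsWeakRibbon : IsWeakRibbon H
    delete-IsWeakRibbon = record { end-σ = end-σ′ ; σ-transitive = σ-transitive′ }
      where
      end-σ′ : ∀ d → end H (σ H d) ≡ end H d
      end-σ′ d with delete-σ d
      ... | inj₁ (j , r , _) = trans (cong (end G) (sym r)) (end-iter (suc j) (L d))
      ... | inj₂ (eq , _) = cong (end H) eq
      orbit : ∀ fuel k d d′ → k ≤ fuel → iter (σ G) k (L d) ≡ L d′ → ∃ λ k′ → iter (σ H) k′ d ≡ d′
      orbit fuel zero d d′ _ eq = 0 , liftDart-injective e eq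
      orbit (suc fuel) (suc k) d d′ (s≤s k≤fuel) eq with delete-σ d
      ... | inj₂ (_ , stays) = ⊥-elim (¬StaysOnEdge d stays)
      ... | inj₁ (j , r , skipped) with j ℕ.≤? k
      ... | no j≰k = ⊥-elim (liftDart-≢ e d′ (trans (cong proj₁ (sym eq)) (skipped k (≰⇒> j≰k))))
      ... | yes j≤k with orbit fuel (k ∸ j) (σ H d) d′ (≤-trans (m∸n≤m k j) k≤fuel) eq′
        where
        eq′ : iter (σ G) (k ∸ j) (L (σ H d)) ≡ L d′
        eq′ = trans (cong (iter (σ G) (k ∸ j)) (sym r))
               (trans (sym (iter-+ (σ G) (k ∸ j) (suc j) (L d)))
                 (trans (cong (λ t → iter (σ G) t (L d)) (trans (+-suc (k ∸ j) j) (cong suc (m∸n+n≡m j≤k)))) eq))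
      ... | k′ , r′ = suc k′ , trans (iter-suc (σ H) k′ d) r′
      σ-transitive′ : ∀ d d′ → end H d ≡ end H d′ → ∃ λ k → iter (σ H) k d ≡ d′
      σ-transitive′ d d′ eq with σ-transitive (L d) (L d′) eq
      ... | k , r = orbit k k d d′ ≤-refl r

  delete-StrongWitnessPair : StrongWitnessPair H → StrongWitnessPair G
  delete-StrongWitnessPair
    (cs , (ne , (z , w) , ue , uv) ,
     sw x y d ds wlk upath xin yin disj mid (a , b , ad , eb , iv) (a′ , b′ , ad′ , eb′ , iv′) x≢y) =
    map L cs , cyc ,
    sw x y (L d) (map L ds) (IsWalk-lift (d ∷ ds) wlk) (Unique-map-liftDart e {d ∷ ds} upath)
        (∈-lift xin) (∈-lift yin) disj′ mid′
        (L a , L b , Adjacent-map L ad , eb , Interval-delete iv)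
        (subst (RightOf′ G (map L cs)) (cong flip (sym (lastD-map L d ds)))
               (L a′ , L b′ , Adjacent-map L ad′ , eb′ , Interval-delete iv′))
        x≢y
    where
    IsWalk-lift : ∀ {p q} cs → IsWalk H p q cs → IsWalk G p q (map L cs)
    IsWalk-lift [] w = w
    IsWalk-lift (c ∷ cs) (p , w) = p , IsWalk-lift cs w
    cyc : IsCycle G (map L cs)
    cyc = (λ q → ne (map-[] cs q)) , (z , IsWalk-lift cs w) , Unique-map-liftDart e ue ,
          Unique-map-transfer (end H) (end G) L (λ q → q) uv
      where
      map-[] : ∀ (xs : List (Dart m)) → map L xs ≡ [] → xs ≡ []
      map-[] [] _ = refl
      map-[] (_ ∷ _) ()
    ∈-lift : ∀ {v} → v ∈ map (end H) cs → v ∈ map (end G) (map L cs)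
    ∈-lift v∈ with ∈-map⁻ (end H) v∈
    ... | c , c∈ , refl = ∈-map-∘ L (end G) c∈
    disj′ : ∀ f → f ∈ map L (d ∷ ds) → proj₁ f ∉ map proj₁ (map L cs)
    disj′ f f∈ e∈ with ∈-map⁻ L f∈ | ∈-map⁻ proj₁ e∈
    ... | f₁ , f₁∈ , refl | c₂ , c₂∈ , q with ∈-map⁻ L c₂∈
    ... | c , c∈ , refl = disj f₁ f₁∈ (subst (_∈ map proj₁ cs) (sym (punchIn-injective e _ _ q)) (∈-map⁺ proj₁ c∈))
    mid′ : ∀ f → f ∈ map L ds → end G f ∉ map (end G) (map L cs)
    mid′ f f∈ e∈ with ∈-map⁻ L f∈ | ∈-map⁻ (end G) e∈
    ... | f₁ , f₁∈ , refl | c₂ , c₂∈ , q with ∈-map⁻ L c₂∈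
    ... | c , c∈ , refl = mid f₁ f₁∈ (subst (_∈ map (end H) cs) (sym q) (∈-map⁺ (end H) c∈))

-- Removing an isolated vertex

module VertexRemoval {n m} (G : RData (suc n) m) (w : Fin (suc n)) (iso : ∀ d → w ≢ end G d) where

  private
    H = removeVertex G w iso

  end-removeVertex : ∀ d → end G d ≡ punchIn w (end H d)
  end-removeVertex d = sym (punchIn-punchOut (iso d))

  end-removeVertex-injective : ∀ {a b} → end G a ≡ end G b → end H a ≡ end H b
  end-removeVertex-injective {a} {b} q =
    punchIn-injective w _ _ (trans (sym (end-removeVertex a)) (trans q (end-removeVertex b)))

  removeVertex-IsWeakRibbon : IsWeakRibbon G → IsWeakRibbon H
  removeVertex-IsWeakRibbon wr = record
    { end-σ = λ d → punchOut-cong w (end-σ d)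
    ; σ-transitive = λ d d′ q → σ-transitive d d′
        (trans (end-removeVertex d) (trans (cong (punchIn w) q) (sym (end-removeVertex d′))))
    }
    where open IsWeakRibbon wr

  removeVertex-StrongWitnessPair : StrongWitnessPair H → StrongWitnessPair G
  removeVertex-StrongWitnessPair
    (cs , (ne , (z , wk) , ue , uv) ,
     sw x y d ds wlk upath xin yin disj mid (a , b , ad , eb , iv) (a′ , b′ , ad′ , eb′ , iv′) x≢y) =
    cs , (ne , (punchIn w z , IsWalk-lift cs wk) , ue , Unique-map-reflect (end H) (end G) end-removeVertex-injective uv) ,
    sw (punchIn w x) (punchIn w y) d ds
        (IsWalk-lift (d ∷ ds) wlk) upath (∈-lift xin) (∈-lift yin) disj mid′
        (a , b , ad , same-end b d eb , iv) (a′ , b′ , ad′ , same-end b′ _ eb′ , iv′)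
        (λ q → x≢y (punchIn-injective w _ _ q))
    where
    same-end : ∀ c c′ → end H c ≡ end H c′ → end G c ≡ end G c′
    same-end c c′ q = trans (end-removeVertex c) (trans (cong (punchIn w) q) (sym (end-removeVertex c′)))
    IsWalk-lift : ∀ {p q} cs → IsWalk H p q cs → IsWalk G (punchIn w p) (punchIn w q) cs
    IsWalk-lift [] refl = refl
    IsWalk-lift (c ∷ cs) (p , wk) =
      trans (end-removeVertex c) (cong (punchIn w) p) ,
      subst (λ t → IsWalk G t _ cs) (sym (end-removeVertex (flip c))) (IsWalk-lift cs wk)
    ∈-lift : ∀ {v} → v ∈ map (end H) cs → punchIn w v ∈ map (end G) cs
    ∈-lift v∈ with ∈-map⁻ (end H) v∈
    ... | c , c∈ , refl = subst (_∈ _) (end-removeVertex c) (∈-map⁺ (end G) c∈)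
    mid′ : ∀ f → f ∈ ds → end G f ∉ map (end G) cs
    mid′ f f∈ e∈ with ∈-map⁻ (end G) e∈
    ... | c , c∈ , q = mid f f∈ (subst (_∈ map (end H) cs) (sym (end-removeVertex-injective q)) (∈-map⁺ (end H) c∈))

-- Contracting an edge

module Contraction {n m} (G : RData (suc n) (suc m)) (e : Fin (suc m)) (nl : end G (e , false) ≢ end G (e , true)) where

  open import Data.List.Membership.DecPropositional (_≟_ {n}) using (_∈?_)

  private
    H = contract G e nl
    L = liftDart e
    u = end G (e , false)
    v = end G (e , true)

  merge : Fin (suc n) → Fin n
  merge = collapse u v nl

  merged : Fin n
  merged = merge v

  OnEdge : Fin (suc n) → Set
  OnEdge z = z ≡ u ⊎ z ≡ v

  merge-u : merge u ≡ merged
  merge-u with v ≟ u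
  ... | yes p = ⊥-elim (nl (sym p))
  ... | no p with v ≟ v
  ... | yes _ = punchOut-cong v refl
  ... | no q = ⊥-elim (q refl)

  merge-identifies : ∀ a b → merge a ≡ merge b → a ≡ b ⊎ (OnEdge a × OnEdge b)
  merge-identifies a b eq with v ≟ a | v ≟ b
  ... | yes p | yes q = inj₁ (trans (sym p) q)
  ... | yes p | no q = inj₂ (inj₂ (sym p) , inj₁ (sym (punchOut-injective _ q eq)))
  ... | no p | yes q = inj₂ (inj₁ (punchOut-injective p _ eq) , inj₂ (sym q))
  ... | no p | no q = inj₁ (punchOut-injective p q eq)

  OnEdge⇒merged : ∀ {z} → OnEdge z → merge z ≡ merged
  OnEdge⇒merged (inj₁ refl) = merge-u
  OnEdge⇒merged (inj₂ refl) = refl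

  merged⇒OnEdge : ∀ {z} → merge z ≡ merged → OnEdge z
  merged⇒OnEdge {z} eq with merge-identifies z v eq
  ... | inj₁ refl = inj₂ refl
  ... | inj₂ (p , _) = p

  merge-injective : ∀ {a b} → merge a ≡ merge b → merge a ≢ merged → a ≡ b
  merge-injective {a} {b} eq ne with merge-identifies a b eq
  ... | inj₁ p = p
  ... | inj₂ (p , _) = ⊥-elim (ne (OnEdge⇒merged p))

  OnEdge-end : ∀ b → OnEdge (end G (e , b))
  OnEdge-end false = inj₁ refl
  OnEdge-end true = inj₂ refl

  edge-end-injective : ∀ {b c} → end G (e , b) ≡ end G (e , c) → b ≡ c
  edge-end-injective {false} {false} _ = refl
  edge-end-injective {true} {true} _ = refl
  edge-end-injective {false} {true} q = ⊥-elim (nl q)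
  edge-end-injective {true} {false} q = ⊥-elim (nl (sym q))

  OnEdge⇒end : ∀ {z} → OnEdge z → ∃ λ b → end G (e , b) ≡ z
  OnEdge⇒end (inj₁ refl) = false , refl
  OnEdge⇒end (inj₂ refl) = true , refl

  -- How contract computes σ H h: follow σ G from L h, crossing e to its other end whenever a dart of e
  -- is reached; stuck is the unreachable fallback of its three-step search.
  data ContractStep (h : Dart m) (r : Dart m) : Set where
    direct : proj₁ (σ G (L h)) ≢ e → L r ≡ σ G (L h) → ContractStep h r
    jump₁ : proj₁ (σ G (L h)) ≡ e → proj₁ (σ G (flip (σ G (L h)))) ≢ e →
         L r ≡ σ G (flip (σ G (L h))) → ContractStep h r
    jump₂ : proj₁ (σ G (L h)) ≡ e → proj₁ (σ G (flip (σ G (L h)))) ≡ e →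
         proj₁ (σ G (flip (σ G (flip (σ G (L h)))))) ≢ e →
         L r ≡ σ G (flip (σ G (flip (σ G (L h))))) → ContractStep h r
    stuck : proj₁ (σ G (L h)) ≡ e → proj₁ (σ G (flip (σ G (L h)))) ≡ e →
         proj₁ (σ G (flip (σ G (flip (σ G (L h)))))) ≡ e → r ≡ h → ContractStep h r

  contract-σ : ∀ h → ContractStep h (σ H h)
  contract-σ (f , b) with e ≟ proj₁ (σ G (punchIn e f , b))
  ... | no p = direct (λ q → p (sym q)) (liftDart-punchOut e p)
  ... | yes p₁ with e ≟ proj₁ (σ G (flip (σ G (punchIn e f , b))))
  ... | no p = jump₁ (sym p₁) (λ q → p (sym q)) (liftDart-punchOut e p)
  ... | yes p₂ with e ≟ proj₁ (σ G (flip (σ G (flip (σ G (punchIn e f , b))))))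
  ... | no p = jump₂ (sym p₁) (sym p₂) (λ q → p (sym q)) (liftDart-punchOut e p)
  ... | yes p₃ = stuck (sym p₁) (sym p₂) (sym p₃) refl

  edge-merged : ∀ g → proj₁ g ≡ e → merge (end G g) ≡ merged
  edge-merged g q = trans (cong (λ t → merge (end G t)) (edge-dart e g q)) (OnEdge⇒merged (OnEdge-end (proj₂ g)))

  edge-dart-by-end : ∀ {g₁ g₂} → proj₁ g₁ ≡ e → proj₁ g₂ ≡ e → end G g₁ ≡ end G g₂ → g₁ ≡ g₂
  edge-dart-by-end {_ , b} {_ , c} refl refl eq = cong (e ,_) (edge-end-injective eq)

  module _ (wr : IsWeakRibbon G) where

    open IsWeakRibbon wr

    before-edge-merged : ∀ h → proj₁ (σ G (L h)) ≡ e → end H h ≡ merged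
    before-edge-merged h q₀ = trans (cong merge (sym (end-σ (L h)))) (edge-merged _ q₀)

    end-σ′ : ∀ d → end H (σ H d) ≡ end H d
    end-σ′ h with contract-σ h
    ... | direct _ q = cong merge (trans (cong (end G) q) (end-σ (L h)))
    ... | jump₁ q₀ _ q =
      trans (cong merge (trans (cong (end G) q) (end-σ _))) (trans (edge-merged _ q₀) (sym (before-edge-merged h q₀)))
    ... | jump₂ q₀ q₁ _ q =
      trans (cong merge (trans (cong (end G) q) (end-σ _))) (trans (edge-merged _ q₁) (sym (before-edge-merged h q₀)))
    ... | stuck _ _ _ q = cong (end H) q

    σ-edge-fixed : ∀ g → proj₁ g ≡ e → proj₁ (σ G g) ≡ e → σ G g ≡ g
    σ-edge-fixed g q q′ = edge-dart-by-end q′ q (end-σ g)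

    ¬edge-fixed : ∀ g h → proj₁ g ≡ e → end G g ≡ end G (L h) → σ G g ≡ g → ⊥
    ¬edge-fixed g h qe eq fx with σ-transitive g (L h) eq
    ... | k , r = liftDart-≢ e h (trans (cong proj₁ (trans (sym r) (iter-fixed (σ G) fx k))) qe)

    ¬stuck : ∀ h → proj₁ (σ G (L h)) ≡ e → proj₁ (σ G (flip (σ G (L h)))) ≡ e →
              proj₁ (σ G (flip (σ G (flip (σ G (L h)))))) ≡ e → ⊥
    ¬stuck h q₀ q₁ q₂ = ¬edge-fixed y₀ h q₀ (end-σ (L h)) fx
      where
      y₀ = σ G (L h)
      y₁ = σ G (flip y₀)
      y₁≡ : y₁ ≡ flip y₀
      y₁≡ = σ-edge-fixed (flip y₀) q₀ q₁
      y₂≡ : σ G (flip y₁) ≡ y₀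
      y₂≡ = edge-dart-by-end q₂ q₀
              (trans (trans (end-σ (flip y₁)) (cong (λ t → end G (flip t)) y₁≡)) (cong (end G) (flip-involutive y₀)))
      fx : σ G y₀ ≡ y₀
      fx = trans (cong (σ G) (sym (flip-involutive y₀))) (trans (cong (λ t → σ G (flip t)) (sym y₁≡)) y₂≡)

    reaches-edge : ∀ j h → proj₁ (iter (σ G) j (L h)) ≡ e →
                ∃ λ k → proj₁ (σ G (L (iter (σ H) k h))) ≡ e × end G (L (iter (σ H) k h)) ≡ end G (L h)
    reaches-edge zero h q = ⊥-elim (liftDart-≢ e h q)
    reaches-edge (suc j) h q with proj₁ (σ G (L h)) ≟ e
    ... | yes p = 0 , p , refl
    ... | no p with contract-σ h
    ... | jump₁ q₀ _ _ = ⊥-elim (p q₀)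
    ... | jump₂ q₀ _ _ _ = ⊥-elim (p q₀)
    ... | stuck q₀ _ _ _ = ⊥-elim (p q₀)
    ... | direct _ r
      with reaches-edge j (σ H h)
          (trans (cong (λ t → proj₁ (iter (σ G) j t)) r) (trans (cong proj₁ (sym (iter-suc (σ G) j (L h)))) q))
    ... | k , q₂ , q₃ = suc k , subst (λ t → proj₁ (σ G (L t)) ≡ e) (sym (iter-suc (σ H) k h)) q₂ ,
                        trans (cong (λ t → end G (L t)) (iter-suc (σ H) k h))
                            (trans q₃ (trans (cong (end G) r) (end-σ (L h))))

    -- After L h, the rotation at the merged vertex visits the other end of e and comes back to σ G (σ G (L h)).
    returns-after-edge : ∀ h → proj₁ (σ G (L h)) ≡ e → proj₁ (σ G (σ G (L h))) ≢ e →
               ∃ λ k → L (iter (σ H) (suc k) h) ≡ σ G (σ G (L h))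
    returns-after-edge h q₀ nq with contract-σ h
    ... | direct p _ = ⊥-elim (p q₀)
    ... | stuck q₀ q₁ q₂ _ = ⊥-elim (¬stuck h q₀ q₁ q₂)
    ... | jump₂ _ q₁ _ r = 0 , trans r (cong (σ G) (trans (cong flip y₁≡) (flip-involutive y₀)))
      where
      y₀ = σ G (L h)
      y₁≡ : σ G (flip y₀) ≡ flip y₀
      y₁≡ = σ-edge-fixed (flip y₀) q₀ q₁
    ... | jump₁ _ q₁ r with σ-transitive (L (σ H h)) (flip (σ G (L h))) (trans (cong (end G) r) (end-σ _))
    ... | j , rⱼ with reaches-edge j (σ H h) (trans (cong proj₁ rⱼ) q₀)
    ... | k , qₖ , eₖ with contract-σ (iter (σ H) k (σ H h))
    ... | direct p _ = ⊥-elim (p qₖ)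
    ... | stuck a b c _ = ⊥-elim (¬stuck _ a b c)
    ... | jump₁ _ _ r′ =
      suc k , trans (cong L (cong (σ H) (iter-suc (σ H) k h)))
          (trans r′ (cong (σ G) (trans (cong flip fe) (flip-involutive _))))
      where
      fe : σ G (L (iter (σ H) k (σ H h))) ≡ flip (σ G (L h))
      fe = edge-dart-by-end qₖ q₀ (trans (end-σ _) (trans eₖ (trans (cong (end G) r) (end-σ _))))
    ... | jump₂ _ q1b _ _ = ⊥-elim (nq (trans (cong (λ t → proj₁ (σ G t)) (sym (trans (cong flip fe) (flip-involutive _)))) q1b))
      where
      fe : σ G (L (iter (σ H) k (σ H h))) ≡ flip (σ G (L h))
      fe = edge-dart-by-end qₖ q₀ (trans (end-σ _) (trans eₖ (trans (cong (end G) r) (end-σ _))))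

    G-orbit⇒H-orbit : ∀ d i → proj₁ (iter (σ G) i (L d)) ≢ e → ∃ λ k → L (iter (σ H) k d) ≡ iter (σ G) i (L d)
    G-orbit⇒H-orbit d zero ne = 0 , refl
    G-orbit⇒H-orbit d (suc i) ne with proj₁ (iter (σ G) i (L d)) ≟ e
    ... | no p with G-orbit⇒H-orbit d i p
    ... | k , r with contract-σ (iter (σ H) k d)
    ... | direct _ q = suc k , trans q (cong (σ G) r)
    ... | jump₁ q₀ _ _ = ⊥-elim (ne (trans (cong (λ t → proj₁ (σ G t)) (sym r)) q₀))
    ... | jump₂ q₀ _ _ _ = ⊥-elim (ne (trans (cong (λ t → proj₁ (σ G t)) (sym r)) q₀))
    ... | stuck q₀ _ _ _ = ⊥-elim (ne (trans (cong (λ t → proj₁ (σ G t)) (sym r)) q₀))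
    G-orbit⇒H-orbit d (suc zero) ne | yes p = ⊥-elim (liftDart-≢ e d p)
    G-orbit⇒H-orbit d (suc (suc i)) ne | yes p with proj₁ (iter (σ G) i (L d)) ≟ e
    ... | yes p0 = ⊥-elim (ne (trans (cong proj₁ fx₂) p0))
      where
      gᵢ = iter (σ G) i (L d)
      eq : σ G gᵢ ≡ gᵢ
      eq = σ-edge-fixed gᵢ p0 p
      fx₂ : σ G (σ G gᵢ) ≡ gᵢ
      fx₂ = trans (cong (σ G) eq) eq
    ... | no p0 with G-orbit⇒H-orbit d i p0
    ... | k , r with returns-after-edge (iter (σ H) k d) (subst (λ t → proj₁ (σ G t) ≡ e) (sym r) p)
                        (subst (λ t → proj₁ (σ G (σ G t)) ≢ e) (sym r) ne)
    ... | k′ , r′ = suc k′ + k , trans (cong L (iter-+ (σ H) (suc k′) k d)) (trans r′ (cong (λ t → σ G (σ G t)) r))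

    same-end-orbit : ∀ d d′ → end G (L d) ≡ end G (L d′) → ∃ λ k → iter (σ H) k d ≡ d′
    same-end-orbit d d′ eq with σ-transitive (L d) (L d′) eq
    ... | i , r with G-orbit⇒H-orbit d i (λ q → liftDart-≢ e d′ (trans (cong proj₁ (sym r)) q))
    ... | k , r′ = k , liftDart-injective e (trans r′ r)

    edge-other-end : ∀ g {t} → proj₁ g ≡ e → OnEdge t → end G g ≢ t → end G (flip g) ≡ t
    edge-other-end (f , b) refl t-on-e ne with OnEdge⇒end t-on-e
    ... | c , refl = other b c ne
      where
      other : ∀ b c → end G (e , b) ≢ end G (e , c) → end G (e , not b) ≡ end G (e , c)
      other false false ne = ⊥-elim (ne refl)
      other true true ne = ⊥-elim (ne refl)
      other false true ne = refl
      other true false ne = refl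

    -- When d and d′ sit at different ends of e, the H-orbit of d reaches d′ by crossing e.
    σ-transitive′ : ∀ d d′ → end H d ≡ end H d′ → ∃ λ k → iter (σ H) k d ≡ d′
    σ-transitive′ d d′ eq with end G (L d) ≟ end G (L d′)
    ... | yes p = same-end-orbit d d′ p
    ... | no p with merge-identifies (end G (L d)) (end G (L d′)) eq
    ... | inj₁ q = ⊥-elim (p q)
    ... | inj₂ (s-on-e , t-on-e) with OnEdge⇒end s-on-e
    ... | β , eβ with σ-transitive (L d) (e , β) (sym eβ)
    ... | j , rⱼ with reaches-edge j d (cong proj₁ rⱼ)
    ... | k , qₖ , eₖ with contract-σ (iter (σ H) k d)
    ... | direct p₂ _ = ⊥-elim (p₂ qₖ)
    ... | stuck a b c _ = ⊥-elim (¬stuck _ a b c)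
    ... | jump₂ q₀ q₁ _ _ =
      ⊥-elim (¬edge-fixed y₁ d′ q₁ (trans (end-σ _) (edge-other-end y₀ q₀ t-on-e (λ z → p (trans (sym (trans (end-σ _) eₖ)) z)))) fx)
      where
      y₀ = σ G (L (iter (σ H) k d))
      y₁ = σ G (flip y₀)
      y₁≡ : y₁ ≡ flip y₀
      y₁≡ = σ-edge-fixed (flip y₀) q₀ q₁
      fx : σ G y₁ ≡ y₁
      fx = cong (σ G) y₁≡
    ... | jump₁ q₀ q₁ r with same-end-orbit (σ H (iter (σ H) k d)) d′
            (trans (cong (end G) r)
             (trans (end-σ _) (edge-other-end y₀ q₀ t-on-e (λ z → p (trans (sym (trans (end-σ _) eₖ)) z)))))
      where y₀ = σ G (L (iter (σ H) k d))
    ... | k′ , r′ = k′ + suc k , trans (iter-+ (σ H) k′ (suc k) d) r′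

    contract-IsWeakRibbon : IsWeakRibbon H
    contract-IsWeakRibbon = record { end-σ = end-σ′ ; σ-transitive = σ-transitive′ }

    edge≢lift : ∀ β X → (e , β) ≢ L X
    edge≢lift β X q = liftDart-≢ e X (cong proj₁ (sym q))

    lift-≢ : ∀ {h X} → h ≢ X → L h ≢ L X
    lift-≢ ne q = ne (liftDart-injective e q)

    edge-dart-at : ∀ {g β} → proj₁ g ≡ e → end G g ≡ end G (e , β) → g ≡ (e , β)
    edge-dart-at q eq = edge-dart-by-end q refl eq

    -- While σ H runs from b to h, σ G from L b is either still at the vertex of L b, or it has crossed e
    -- at (e , β) and h lies at the other end of e.
    Progress : Dart m → Dart m → ℕ → Set
    Progress b h k′ = (iter (σ G) k′ (L b) ≡ L h × end G (L h) ≡ end G (L b)) ⊎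
                (∃ λ β → end G (e , β) ≡ end G (L b) × iter (σ G) k′ (L b) ≡ (e , β) × end G (L h) ≡ end G (e , not β))

    Interval-contract-steps : ∀ b X k → Avoid (σ H) b k X → ∃ λ k′ →
                              Avoid (σ G) (L b) k′ (L X) × Progress b (iter (σ H) k b) k′
    Interval-contract-steps b X zero av = 0 , Avoid-zero (σ G) , inj₁ (refl , refl)
    Interval-contract-steps b X (suc k) av with Interval-contract-steps b X k (Avoid-pred (σ H) k av)
    ... | k′ , avoid′ , st with contract-σ (iter (σ H) k b) | st
    ... | direct _ q | inj₁ (r , ends) = suc k′ , Avoid-suc (σ G) k′ avoid′ (subst (_≢ L X) (sym r) h≢X) ,
          inj₁ (trans (cong (σ G) r) (sym q) , trans (cong (end G) q) (trans (end-σ _) ends))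
      where h≢X = lift-≢ (av k (n<1+n k))
    ... | jump₁ q₀ _ q | inj₁ (r , ends) =
          suc k′ , Avoid-suc (σ G) k′ avoid′ (subst (_≢ L X) (sym r) (lift-≢ (av k (n<1+n k)))) ,
          inj₂ (proj₂ y₀ , trans (cong (end G) (sym y₀≡)) (trans (end-σ _) ends) , trans (cong (σ G) r) y₀≡ ,
                trans (cong (end G) q) (trans (end-σ _) (cong (λ t → end G (flip t)) y₀≡)))
      where
      y₀ = σ G (L (iter (σ H) k b))
      y₀≡ : y₀ ≡ (e , proj₂ y₀)
      y₀≡ = edge-dart e y₀ q₀
    ... | jump₂ q₀ q₁ _ q | inj₁ (r , ends) = suc (suc k′) ,
          Avoid-suc (σ G) (suc k′) (Avoid-suc (σ G) k′ avoid′ (subst (_≢ L X) (sym r) (lift-≢ (av k (n<1+n k)))))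
                (λ z → liftDart-≢ e X (trans (cong proj₁ (sym z)) (trans (cong (λ t → proj₁ (σ G t)) r) q₀))) ,
          inj₁ (trans (cong (λ t → σ G (σ G t)) r) (trans (cong (σ G) (sym (trans (cong flip y₁≡) (flip-involutive y₀)))) (sym q)) ,
                trans (cong (end G) q)
                    (trans (end-σ _)
                     (trans (cong (λ t → end G (flip t)) y₁≡)
                      (trans (cong (end G) (flip-involutive y₀)) (trans (end-σ _) ends)))))
      where
      y₀ = σ G (L (iter (σ H) k b))
      y₁≡ : σ G (flip y₀) ≡ flip y₀
      y₁≡ = σ-edge-fixed (flip y₀) q₀ q₁
    ... | stuck _ _ _ q | inj₁ (r , ends) = k′ , avoid′ , inj₁
        (trans r (cong L (sym q)) , trans (cong (λ t → end G (L t)) q) ends)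
    ... | direct _ q | inj₂ (β , eβ , r , ends′) = k′ , avoid′ , inj₂
        (β , eβ , r , trans (cong (end G) q) (trans (end-σ _) ends′))
    ... | jump₁ q₀ _ q | inj₂ (β , eβ , r , ends′) =
          suc k′ , Avoid-suc (σ G) k′ avoid′ (subst (_≢ L X) (sym r) (edge≢lift β X)) ,
          inj₁ (trans (cong (σ G) r) (sym (trans q (cong (σ G) (trans (cong flip y₀≡) (cong (e ,_) (not-involutive β)))))) ,
                trans (cong (end G) q)
                    (trans (end-σ _)
                     (trans (cong (λ t → end G (flip t)) y₀≡) (trans (cong (λ t → end G (e , t)) (not-involutive β)) eβ))))
      where
      y₀ = σ G (L (iter (σ H) k b))
      y₀≡ : y₀ ≡ (e , not β)
      y₀≡ = edge-dart-at q₀ (trans (end-σ _) ends′)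
    ... | jump₂ q₀ q₁ _ q | inj₂ (β , eβ , r , ends′) = k′ , avoid′ , inj₂ (β , eβ , r ,
          trans (cong (end G) q)
              (trans (end-σ _)
               (trans (cong (λ t → end G (flip t)) y₁≡)
                (trans (cong (end G) (flip-involutive y₀)) (trans (end-σ _) ends′)))))
      where
      y₀ = σ G (L (iter (σ H) k b))
      y₁≡ : σ G (flip y₀) ≡ flip y₀
      y₁≡ = σ-edge-fixed (flip y₀) q₀ q₁
    ... | stuck _ _ _ q | inj₂ (β , eβ , r , ends′) = k′ , avoid′ , inj₂
        (β , eβ , r , trans (cong (λ t → end G (L t)) q) ends′)

    Interval-contract : ∀ {b X z} → Interval H b X z →
              (end G (L z) ≡ end G (L b) × Interval G (L b) (L X) (L z)) ⊎
              (∃ λ β → end G (e , β) ≡ end G (L b) × Interval G (L b) (L X) (e , β) × end G (L z) ≡ end G (e , not β))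
    Interval-contract {b} {X} {z} (k , r , av) with Interval-contract-steps b X k av
    ... | k′ , avoid′ , inj₁ (r′ , ends) = inj₁ (subst (λ t → end G (L t) ≡ end G (L b)) r ends , k′ , trans r′ (cong L r) , avoid′)
    ... | k′ , avoid′ , inj₂ (β , eβ , r′ , ends′) = inj₂ (β , eβ , (k′ , r′ , avoid′) , subst (λ t → end G (L t) ≡ end G (e , not β)) r ends′)

    -- When b and X sit at different ends of e, σ H runs from L b up to (e , β) and then from (e , not β) up to L X.
    Phase : Dart m → Dart m → Bool → Dart m → ℕ → Set
    Phase b X β h k′ = (iter (σ G) k′ (L b) ≡ L h × Avoid (σ G) (L b) k′ (e , β) × end G (L h) ≡ end G (e , β)) ⊎
                    (iter (σ G) k′ (e , not β) ≡ L h × Avoid (σ G) (e , not β) k′ (L X) × end G (L h) ≡ end G (e , not β))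

    ¬returns : ∀ β X k′ {h} → h ≢ X → proj₁ (σ G (L h)) ≡ e → iter (σ G) k′ (e , not β) ≡ L h →
           Avoid (σ G) (e , not β) k′ (L X) → end G (L h) ≡ end G (e , not β) → end G (L X) ≡ end G (e , not β) → ⊥
    ¬returns β X k′ {h} h≢X q₀ r avoid′ ends eX with σ-transitive (e , not β) (L X) (sym eX)
    ... | k , r′ = Avoid-periodic (σ G) k′ per (Avoid-suc (σ G) k′ avoid′ (subst (_≢ L X) (sym r) (lift-≢ h≢X))) k r′
      where
      per : iter (σ G) (suc k′) (e , not β) ≡ (e , not β)
      per = trans (cong (σ G) r) (edge-dart-at q₀ (trans (end-σ _) ends))

    Interval-contract-merged-steps : ∀ b X β → end G (L b) ≡ end G (e , β) → end G (L X) ≡ end G (e , not β) →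
             ∀ k → Avoid (σ H) b k X → ∃ λ k′ → Phase b X β (iter (σ H) k b) k′
    Interval-contract-merged-steps b X β eb eX zero av = 0 , inj₁ (refl , Avoid-zero (σ G) , eb)
    Interval-contract-merged-steps b X β eb eX (suc k) av
      with Interval-contract-merged-steps b X β eb eX k (Avoid-pred (σ H) k av)
    ... | k′ , st with contract-σ (iter (σ H) k b) | st
    ... | direct _ q | inj₁ (r , avoid′ , ends) =
      suc k′ , inj₁ (trans (cong (σ G) r) (sym q) ,
                     Avoid-suc (σ G) k′ avoid′ (λ z → liftDart-≢ e (iter (σ H) k b) (cong proj₁ (trans (sym r) z))) ,
                     trans (cong (end G) q) (trans (end-σ _) ends))
    ... | direct _ q | inj₂ (r , avoid′ , ends) =
      suc k′ , inj₂ (trans (cong (σ G) r) (sym q) ,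
                     Avoid-suc (σ G) k′ avoid′ (subst (_≢ L X) (sym r) (lift-≢ (av k (n<1+n k)))) ,
                     trans (cong (end G) q) (trans (end-σ _) ends))
    ... | jump₁ q₀ _ q | inj₁ (r , avoid′ , ends) = 1 , inj₂ (sym (trans q (cong (λ t → σ G (flip t)) y₀≡)) ,
            (λ { zero _ → λ z → liftDart-≢ e X (cong proj₁ (sym z)) ; (suc j) (s≤s ()) }) ,
            trans (cong (end G) q) (trans (end-σ _) (cong (λ t → end G (flip t)) y₀≡)))
      where
      y₀≡ : σ G (L (iter (σ H) k b)) ≡ (e , β)
      y₀≡ = edge-dart-at q₀ (trans (end-σ _) ends)
    ... | jump₂ q₀ q₁ _ _ | inj₁ (r , avoid′ , ends) = ⊥-elim (¬edge-fixed (e , not β) X refl (sym eX) fx)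
      where
      y₀≡ : σ G (L (iter (σ H) k b)) ≡ (e , β)
      y₀≡ = edge-dart-at q₀ (trans (end-σ _) ends)
      fx : σ G (e , not β) ≡ (e , not β)
      fx = edge-dart-at (trans (cong (λ t → proj₁ (σ G (flip t))) (sym y₀≡)) q₁) (end-σ _)
    ... | stuck q₀ q₁ _ _ | inj₁ (r , avoid′ , ends) = ⊥-elim (¬edge-fixed (e , not β) X refl (sym eX) fx)
      where
      y₀≡ : σ G (L (iter (σ H) k b)) ≡ (e , β)
      y₀≡ = edge-dart-at q₀ (trans (end-σ _) ends)
      fx : σ G (e , not β) ≡ (e , not β)
      fx = edge-dart-at (trans (cong (λ t → proj₁ (σ G (flip t))) (sym y₀≡)) q₁) (end-σ _)
    ... | jump₁ q₀ _ _ | inj₂ (r , avoid′ , ends) = ⊥-elim (¬returns β X k′ (av k (n<1+n k)) q₀ r avoid′ ends eX)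
    ... | jump₂ q₀ _ _ _ | inj₂ (r , avoid′ , ends) = ⊥-elim (¬returns β X k′ (av k (n<1+n k)) q₀ r avoid′ ends eX)
    ... | stuck q₀ _ _ _ | inj₂ (r , avoid′ , ends) = ⊥-elim (¬returns β X k′ (av k (n<1+n k)) q₀ r avoid′ ends eX)

    Interval-contract-merged : ∀ {b X z} β → end G (L b) ≡ end G (e , β) → end G (L X) ≡ end G (e , not β) →
                               Interval H b X z →
          (end G (L z) ≡ end G (e , β) × Interval G (L b) (e , β) (L z)) ⊎
          (end G (L z) ≡ end G (e , not β) × Interval G (e , not β) (L X) (L z))
    Interval-contract-merged {b} {X} {z} β eb eX (k , r , av) with Interval-contract-merged-steps b X β eb eX k av
    ... | k′ , inj₁ (r′ , avoid′ , ends) = inj₁ (subst (λ t → end G (L t) ≡ _) r ends , k′ , trans r′ (cong L r) , avoid′)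
    ... | k′ , inj₂ (r′ , avoid′ , ends) = inj₂ (subst (λ t → end G (L t) ≡ _) r ends , k′ , trans r′ (cong L r) , avoid′)

    AvoidsMerged : List (Dart m) → Set
    AvoidsMerged = Avoids H merged

    IsWalk-lift : ∀ {p q} d ds → IsWalk H p q (d ∷ ds) → AvoidsMerged ds →
            IsWalk G (end G (L d)) (end G (flip (L (lastD d ds)))) (map L (d ∷ ds))
    IsWalk-lift d [] w avoids = refl , refl
    IsWalk-lift d (d′ ∷ ds) (_ , w) avoids = refl ,
      subst (λ t → IsWalk G t (end G (flip (L (lastD d′ ds)))) (map L (d′ ∷ ds)))
            (merge-injective {end G (L d′)} {end G (flip (L d))} (proj₁ w) (avoids d′ (here refl)))
            (IsWalk-lift d′ ds w (λ f f∈ → avoids f (there f∈)))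

    Unique-ends-lift : ∀ {xs} → Unique (map (end H) xs) → Unique (map (end G) (map L xs))
    Unique-ends-lift = Unique-map-transfer (end H) (end G) L (cong merge)

    All-insert-edge : ∀ {x} ps qs β → All (proj₁ x ≢_) (map proj₁ (ps ++ qs)) →
             All (proj₁ (L x) ≢_) (map proj₁ (map L ps ++ (e , β) ∷ map L qs))
    All-insert-edge {x} [] [] β [] = (λ q → liftDart-≢ e x q) ∷ []
    All-insert-edge {x} [] (p ∷ qs) β (a ∷ as) with All-insert-edge {x} [] qs β as
    ... | a₁ ∷ as₁ = a₁ ∷ (λ q → a (punchIn-injective e (proj₁ x) (proj₁ p) q)) ∷ as₁
    All-insert-edge {x} (p ∷ ps) qs β (a ∷ as) = (λ q → a (punchIn-injective e (proj₁ x) (proj₁ p) q)) ∷ All-insert-edge {x} ps qs β as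

    All-edge-≢ : ∀ xs → All (e ≢_) (map proj₁ (map L xs))
    All-edge-≢ [] = []
    All-edge-≢ (x ∷ xs) = (λ q → liftDart-≢ e x (sym q)) ∷ All-edge-≢ xs

    Unique-insert-edge : ∀ ps qs β → Unique (map proj₁ (ps ++ qs)) → Unique (map proj₁ (map L ps ++ (e , β) ∷ map L qs))
    Unique-insert-edge [] qs β u = All-edge-≢ qs ∷ Unique-map-liftDart e {qs} u
    Unique-insert-edge (p ∷ ps) qs β (a ∷ u) = All-insert-edge {p} ps qs β a ∷ Unique-insert-edge ps qs β u

    merge-∈ : ∀ {z cs} → z ∈ map (end G) (map L cs) → merge z ∈ map (end H) cs
    merge-∈ {cs = cs} z∈ with ∈-map⁻ (end G) z∈
    ... | g , g∈ , refl with ∈-map⁻ L g∈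
    ... | c , c∈ , refl = ∈-map⁺ (end H) c∈

    ∈-lift : ∀ {z cs} → merge z ∈ map (end H) cs → merge z ≢ merged → z ∈ map (end G) (map L cs)
    ∈-lift {z} {cs} z∈ ne with ∈-map⁻ (end H) z∈
    ... | c , c∈ , eq = subst (_∈ map (end G) (map L cs))
        (merge-injective {end G (L c)} {z} (sym eq) (λ q → ne (trans eq q))) (∈-map-∘ L (end G) c∈)

    edges-off-lift : ∀ {f cs} → proj₁ f ∉ map proj₁ cs → proj₁ (L f) ∉ map proj₁ (map L cs)
    edges-off-lift {f} {cs} nf q with ∈-map⁻ proj₁ q
    ... | g , g∈ , eq with ∈-map⁻ L g∈
    ... | c , c∈ , refl = nf (subst (_∈ map proj₁ cs) (sym (punchIn-injective e (proj₁ f) (proj₁ c) eq)) (∈-map⁺ proj₁ c∈))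

    edges-off-lift-++ : ∀ {f cs} → proj₁ f ∉ map proj₁ cs → ∀ extra → All (λ g → proj₁ g ≡ e) extra →
                        proj₁ (L f) ∉ map proj₁ (map L cs ++ extra)
    edges-off-lift-++ {f} {cs} nf extra ae q with ∈-map⁻ proj₁ q
    ... | g , g∈ , eq with ∈-++⁻ (map L cs) g∈
    ... | inj₁ g∈₁ = edges-off-lift {f} {cs} nf (subst (_∈ map proj₁ (map L cs)) (sym eq) (∈-map⁺ proj₁ g∈₁))
    ... | inj₂ g∈₂ = liftDart-≢ e f (trans eq (All.lookup ae g∈₂))

    edge-off-lift : ∀ {g : Dart (suc m)} cs → proj₁ g ≡ e → proj₁ g ∉ map proj₁ (map L cs)
    edge-off-lift {g} cs qe q with ∈-map⁻ proj₁ q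
    ... | g₂ , g₂∈ , eq with ∈-map⁻ L g₂∈
    ... | c , c∈ , refl = liftDart-≢ e c (trans (sym eq) qe)

    Interval-contract-away : ∀ {b X z} → end H b ≢ merged → Interval H b X z →
                             end G (L z) ≡ end G (L b) × Interval G (L b) (L X) (L z)
    Interval-contract-away avoids iv with Interval-contract iv
    ... | inj₁ r = r
    ... | inj₂ (β , eβ , _ , _) = ⊥-elim (avoids (trans (cong merge (sym eβ)) (OnEdge⇒merged (OnEdge-end β))))

    LeftOf′-lift : ∀ {cs C′ d} → (∀ {a b} → Adjacent cs a b → end H b ≢ merged → Adjacent C′ (L a) (L b)) →
               LeftOf′ H cs d → end H d ≢ merged → LeftOf′ G C′ (L d)
    LeftOf′-lift adjacent-lift (a , b , ad , eb , iv) avoids with Interval-contract-away (λ q → avoids (trans (sym eb) q)) iv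
    ... | _ , iv′ = L a , L b , adjacent-lift ad (λ q → avoids (trans (sym eb) q)) ,
                    merge-injective eb (λ q → avoids (trans (sym eb) q)) , iv′

    RightOf′-lift : ∀ {cs C′ z} → (∀ {a b} → Adjacent cs a b → end H b ≢ merged → Adjacent C′ (L a) (L b)) →
                (∀ {a b} → Adjacent cs a b → end H (flip a) ≡ end H b) →
                RightOf′ H cs z → end H z ≢ merged → RightOf′ G C′ (L z)
    RightOf′-lift adjacent-lift adjacent-link (a , b , ad , eb , iv) avoids with Interval-contract-away
        (λ q → avoids (trans (sym eb) (trans (sym (adjacent-link ad)) q))) iv
    ... | _ , iv′ = L a , L b , adjacent-lift ad (λ q → avoids (trans (sym eb) q)) ,
                    merge-injective eb (λ q → avoids (trans (sym eb) q)) , iv′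

    IsCycle-lift : ∀ cs → IsCycle H cs → merged ∉ map (end H) cs → IsCycle G (map L cs)
    IsCycle-lift [] (ne , _) _ = ⊥-elim (ne refl)
    IsCycle-lift (c₁ ∷ cs₁) (ne , (z , w) , ue , uv) merged∉ = (λ ()) , (end G (L c₁) , lifted) ,
        Unique-map-liftDart e {c₁ ∷ cs₁} ue , Unique-ends-lift {c₁ ∷ cs₁} uv
      where
      avoids : AvoidsMerged cs₁
      avoids f f∈ q = merged∉ (subst (_∈ map (end H) (c₁ ∷ cs₁)) q (∈-map⁺ (end H) (there f∈)))
      closes : end G (flip (L (lastD c₁ cs₁))) ≡ end G (L c₁)
      closes = merge-injective (trans (IsWalk-last H c₁ cs₁ w) (sym (proj₁ w)))
                  (λ q → merged∉
                   (subst (_∈ map (end H) (c₁ ∷ cs₁)) (trans (proj₁ w) (trans (sym (IsWalk-last H c₁ cs₁ w)) q))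
                    (here refl)))
      lifted : IsWalk G (end G (L c₁)) (end G (L c₁)) (map L (c₁ ∷ cs₁))
      lifted = subst (λ t → IsWalk G (end G (L c₁)) t (map L (c₁ ∷ cs₁))) closes (IsWalk-lift c₁ cs₁ w avoids)

    -- A path of H that avoids the merged vertex inside lifts along any lift C′ of its cycle.
    module Lift {cs : List (Dart m)} (C′ : List (Dart (suc m))) (C′-cycle : IsCycle G C′)
                (edges-off′ : ∀ f → proj₁ f ∉ map proj₁ cs → proj₁ (L f) ∉ map proj₁ C′)
                (interior-off′ : ∀ g → merge (end G g) ∉ map (end H) cs → end G g ∉ map (end G) C′) where

      lift-path : (P : StrongWitness H cs) → AvoidsMerged (rest P) →
                  end G (L (first P)) ∈ map (end G) C′ → end G (flip (L (last P))) ∈ map (end G) C′ →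
                  LeftOf′ G C′ (L (first P)) → RightOf′ G C′ (flip (L (last P))) → StrongWitnessPair G
      lift-path (sw x y d ds wlk upath _ _ disj mid _ _ x≢y) avoids xin yin lft rgt =
        C′ , C′-cycle ,
        sw _ _ (L d) (map L ds) (IsWalk-lift d ds wlk avoids) (Unique-map-liftDart e {d ∷ ds} upath) xin yin
           edges-off″ interior-off″ lft (subst (RightOf′ G C′) (cong flip (sym (lastD-map L d ds))) rgt)
           (λ q → x≢y (trans (sym (proj₁ wlk)) (trans (cong merge q) (IsWalk-last H d ds wlk))))
        where
        edges-off″ : ∀ f → f ∈ map L (d ∷ ds) → proj₁ f ∉ map proj₁ C′
        edges-off″ f f∈ with ∈-map⁻ L f∈
        ... | f₁ , f₁∈ , refl = edges-off′ f₁ (disj f₁ f₁∈)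
        interior-off″ : ∀ f → f ∈ map L ds → end G f ∉ map (end G) C′
        interior-off″ f f∈ with ∈-map⁻ L f∈
        ... | f₁ , f₁∈ , refl = interior-off′ (L f₁) (mid f₁ f₁∈)

      module _ (e-off : ∀ (g : Dart (suc m)) → proj₁ g ≡ e → proj₁ g ∉ map proj₁ C′) where

        lift-path-prepend : ∀ β (P : StrongWitness H cs) → AvoidsMerged (rest P) →
                            end G (flip (e , β)) ≡ end G (L (first P)) → end G (L (first P)) ∉ map (end G) C′ →
                            end G (e , β) ∈ map (end G) C′ → end G (flip (L (last P))) ∈ map (end G) C′ →
                            LeftOf′ G C′ (e , β) → RightOf′ G C′ (flip (L (last P))) →
                            end G (e , β) ≢ end G (flip (L (last P))) → StrongWitnessPair G
        lift-path-prepend β (sw x y d ds wlk upath _ _ disj mid _ _ _) avoids links d∉ xin yin lft rgt x≢y =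
          C′ , C′-cycle ,
          sw _ _ (e , β) (map L (d ∷ ds))
             (refl , subst (λ t → IsWalk G t (end G (flip (L (lastD d ds)))) (map L (d ∷ ds))) (sym links)
                           (IsWalk-lift d ds wlk avoids))
             (Unique-insert-edge [] (d ∷ ds) β upath) xin yin edges-off″ interior-off″ lft
             (subst (RightOf′ G C′) (cong flip (sym (lastD-map L d ds))) rgt) x≢y
          where
          edges-off″ : ∀ f → f ∈ (e , β) ∷ map L (d ∷ ds) → proj₁ f ∉ map proj₁ C′
          edges-off″ f (here refl) = e-off (e , β) refl
          edges-off″ f (there f∈) with ∈-map⁻ L f∈
          ... | f₁ , f₁∈ , refl = edges-off′ f₁ (disj f₁ f₁∈)
          interior-off″ : ∀ f → f ∈ map L (d ∷ ds) → end G f ∉ map (end G) C′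
          interior-off″ f (here refl) = d∉
          interior-off″ f (there f∈) with ∈-map⁻ L f∈
          ... | f₁ , f₁∈ , refl = interior-off′ (L f₁) (mid f₁ f₁∈)

        lift-path-append : ∀ β (P : StrongWitness H cs) → AvoidsMerged (rest P) →
                           end G (flip (L (last P))) ≡ end G (e , β) → end G (e , β) ∉ map (end G) C′ →
                           end G (L (first P)) ∈ map (end G) C′ → end G (flip (e , β)) ∈ map (end G) C′ →
                           LeftOf′ G C′ (L (first P)) → RightOf′ G C′ (flip (e , β)) →
                           end G (L (first P)) ≢ end G (flip (e , β)) → StrongWitnessPair G
        lift-path-append β (sw x y d ds wlk upath _ _ disj mid _ _ _) avoids links l∉ xin yin lft rgt x≢y =
          C′ , C′-cycle ,
          sw _ _ (L d) (map L ds ++ [ e , β ])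
             (IsWalk-++ G (map L (d ∷ ds)) [ e , β ] (IsWalk-lift d ds wlk avoids) (sym links , refl))
             (Unique-insert-edge (d ∷ ds) [] β (subst (λ t → Unique (map proj₁ t)) (sym (++-identityʳ (d ∷ ds))) upath))
             xin yin edges-off″ interior-off″ lft
             (subst (λ t → RightOf′ G C′ (flip t)) (sym (lastD-++ (L d) (map L ds) (e , β) [])) rgt) x≢y
          where
          edges-off″ : ∀ f → f ∈ map L (d ∷ ds) ++ [ e , β ] → proj₁ f ∉ map proj₁ C′
          edges-off″ f f∈ with ∈-++⁻ (map L (d ∷ ds)) f∈
          ... | inj₂ (here refl) = e-off (e , β) refl
          ... | inj₁ f∈₁ with ∈-map⁻ L f∈₁
          ... | f₁ , f₁∈ , refl = edges-off′ f₁ (disj f₁ f₁∈)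
          interior-off″ : ∀ f → f ∈ map L ds ++ [ e , β ] → end G f ∉ map (end G) C′
          interior-off″ f f∈ with ∈-++⁻ (map L ds) f∈
          ... | inj₂ (here refl) = l∉
          ... | inj₁ f∈₁ with ∈-map⁻ L f∈₁
          ... | f₁ , f₁∈ , refl = interior-off′ (L f₁) (mid f₁ f₁∈)

    -- If the cycle avoids the merged vertex it lifts verbatim; so does the path, except that where it passes
    -- through the merged vertex, entering and leaving at different ends of e, the dart of e is inserted.
    module CycleAvoidsMerged {cs : List (Dart m)} (cyc : IsCycle H cs) (merged∉ : merged ∉ map (end H) cs) where

      private
        C′ = map L cs
        C′-cycle = IsCycle-lift cs cyc merged∉
        adjacent-lift : ∀ {a b} → Adjacent cs a b → end H b ≢ merged → Adjacent C′ (L a) (L b)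
        adjacent-lift ad _ = Adjacent-map L ad
        adjacent-link : ∀ {a b} → Adjacent cs a b → end H (flip a) ≡ end H b
        adjacent-link = closedWalk-Adjacent H (proj₂ (proj₁ (proj₂ cyc)))
        ≢merged : ∀ {v} → v ∈ map (end H) cs → v ≢ merged
        ≢merged v∈ q = merged∉ (subst (_∈ map (end H) cs) q v∈)
        ∈-C′ : ∀ {X v} → merge X ≡ v → v ∈ map (end H) cs → X ∈ map (end G) C′
        ∈-C′ refl v∈ = ∈-lift v∈ (≢merged v∈)
        ∉-C′ : ∀ {g} → merge (end G g) ∉ map (end H) cs → end G g ∉ map (end G) C′
        ∉-C′ nc q = nc (merge-∈ {cs = cs} q)

      open Lift C′ C′-cycle (λ f → edges-off-lift {f} {cs}) (λ g → ∉-C′ {g})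

      lift-avoiding : (P : StrongWitness H cs) → AvoidsMerged (rest P) → StrongWitnessPair G
      lift-avoiding P@(sw x y d ds wlk upath xin yin disj mid lft rgt x≢y) avoids =
        lift-path P avoids (∈-C′ (proj₁ wlk) xin) (∈-C′ y-end yin)
          (LeftOf′-lift adjacent-lift lft (λ q → ≢merged xin (trans (sym (proj₁ wlk)) q)))
          (RightOf′-lift adjacent-lift adjacent-link rgt (λ q → ≢merged yin (trans (sym y-end) q)))
        where
        y-end : end H (flip (lastD d ds)) ≡ y
        y-end = IsWalk-last H d ds wlk

      lift-through-merged : (P : StrongWitness H cs) → ∀ A q D → rest P ≡ A ++ q ∷ D →
                            AvoidsMerged A → AvoidsMerged D → end H q ≡ merged → StrongWitnessPair G
      lift-through-merged (sw x y d _ wlk upath xin yin disj mid lft rgt x≢y) A q D refl A-avoids D-avoids q-at-merged =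
        join (z₁ ≟ z₂)
        where
        split = IsWalk-++⁻ H (d ∷ A) (q ∷ D) wlk
        w₁ = proj₁ (proj₂ split)
        w₂ = proj₂ (proj₂ split)
        z₁ = end G (flip (L (lastD d A)))
        z₂ = end G (L q)
        y-end : end H (flip (lastD q D)) ≡ y
        y-end = IsWalk-last H q D w₂
        insert : ∀ ins → IsWalk G z₁ z₂ ins → All (λ g → proj₁ g ≡ e) ins →
                 Unique (map proj₁ (map L (d ∷ A) ++ ins ++ map L (q ∷ D))) → StrongWitnessPair G
        insert ins wi ae u =
          C′ , C′-cycle ,
          sw _ _ (L d) (map L A ++ ins ++ map L (q ∷ D))
             (IsWalk-++ G (map L (d ∷ A)) (ins ++ map L (q ∷ D)) (IsWalk-lift d A w₁ A-avoids)
                        (IsWalk-++ G ins (map L (q ∷ D)) wi (IsWalk-lift q D w₂ D-avoids)))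
             u (∈-C′ (proj₁ wlk) xin) (∈-C′ y-end yin) edges-off″ interior-off″
             (LeftOf′-lift adjacent-lift lft (λ q₂ → ≢merged xin (trans (sym (proj₁ wlk)) q₂)))
             (subst (RightOf′ G C′) (cong flip (sym same-last))
                    (RightOf′-lift adjacent-lift adjacent-link (subst (RightOf′ H cs) (cong flip (lastD-++ d A q D)) rgt)
                                   (λ q₂ → ≢merged yin (trans (sym y-end) q₂))))
             (λ q₂ → x≢y (trans (sym (proj₁ wlk)) (trans (cong merge q₂) y-end)))
          where
          same-last : lastD (L d) (map L A ++ ins ++ map L (q ∷ D)) ≡ L (lastD q D)
          same-last = trans (cong (lastD (L d)) (sym (++-assoc (map L A) ins (map L (q ∷ D)))))
                            (trans (lastD-++ (L d) (map L A ++ ins) (L q) (map L D)) (lastD-map L q D))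
          edges-off″ : ∀ f → f ∈ map L (d ∷ A) ++ ins ++ map L (q ∷ D) → proj₁ f ∉ map proj₁ C′
          edges-off″ f f∈ with ∈-++⁻ (map L (d ∷ A)) f∈
          ... | inj₁ f∈₁ with ∈-map⁻ L f∈₁
          ... | f₁ , here refl , refl = edges-off-lift {f₁} {cs} (disj f₁ (here refl))
          ... | f₁ , there f₁∈ , refl = edges-off-lift {f₁} {cs} (disj f₁ (there (∈-++⁺ˡ f₁∈)))
          edges-off″ f f∈ | inj₂ f∈₂ with ∈-++⁻ ins f∈₂
          ... | inj₁ fᵢ = edge-off-lift {f} cs (All.lookup ae fᵢ)
          ... | inj₂ f∈₃ with ∈-map⁻ L f∈₃
          ... | f₁ , f₁∈ , refl = edges-off-lift {f₁} {cs} (disj f₁ (there (∈-++⁺ʳ A f₁∈)))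
          interior-off″ : ∀ f → f ∈ map L A ++ ins ++ map L (q ∷ D) → end G f ∉ map (end G) C′
          interior-off″ f f∈ with ∈-++⁻ (map L A) f∈
          ... | inj₁ f∈₁ with ∈-map⁻ L f∈₁
          ... | f₁ , f₁∈ , refl = ∉-C′ (mid f₁ (∈-++⁺ˡ f₁∈))
          interior-off″ f f∈ | inj₂ f∈₂ with ∈-++⁻ ins f∈₂
          ... | inj₁ fᵢ = λ q₂ → merged∉ (subst (_∈ map (end H) cs) (edge-merged f (All.lookup ae fᵢ)) (merge-∈ {cs = cs} q₂))
          ... | inj₂ f∈₃ with ∈-map⁻ L f∈₃
          ... | f₁ , f₁∈ , refl = ∉-C′ (mid f₁ (∈-++⁺ʳ A f₁∈))
        z₁-on-e : OnEdge z₁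
        z₁-on-e = merged⇒OnEdge (trans (IsWalk-last H d A w₁) (trans (sym (proj₁ w₂)) q-at-merged))
        join : Dec (z₁ ≡ z₂) → StrongWitnessPair G
        join (yes eq) = insert [] eq []
          (subst (λ t → Unique (map proj₁ t)) (map-++ L (d ∷ A) (q ∷ D)) (Unique-map-liftDart e {d ∷ A ++ q ∷ D} upath))
        join (no ne) with OnEdge⇒end z₁-on-e
        ... | β , eβ = insert [ e , β ] (eβ , edge-other-end (e , β) refl (merged⇒OnEdge q-at-merged) (λ q₂ → ne (trans (sym eβ) q₂)))
                              (refl ∷ []) (Unique-insert-edge (d ∷ A) (q ∷ D) β upath)

    -- If the cycle starts at the merged vertex, its lift closes up in G, or else needs the dart of e appended.
    -- A path end at the merged vertex may then have to be moved across e, which is what the interval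
    -- lemmas decide.
    module CycleThroughMerged (c : Dart m) (B : List (Dart m)) (cyc : IsCycle H (c ∷ B))
        (c-at-merged : end H c ≡ merged) where
      cs = c ∷ B
      w = proj₂ (proj₁ (proj₂ cyc))
      ue = proj₁ (proj₂ (proj₂ cyc))
      uv = proj₂ (proj₂ (proj₂ cyc))
      l = lastD c B
      rest-avoids-merged : AvoidsMerged B
      rest-avoids-merged f f∈ q with uv
      ... | pc ∷ _ = All.lookup pc (∈-map⁺ (end H) f∈) (trans c-at-merged (sym q))
      start = end G (L c)
      stop = end G (flip (L l))
      C′-walk : IsWalk G start stop (map L cs)
      C′-walk = IsWalk-lift c B w rest-avoids-merged
      merge-stop : merge stop ≡ merged
      merge-stop = trans (IsWalk-last H c B w) (trans (sym (proj₁ w)) c-at-merged)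
      start-on-e : OnEdge start
      start-on-e = merged⇒OnEdge c-at-merged
      stop-on-e : OnEdge stop
      stop-on-e = merged⇒OnEdge merge-stop
      adjacent-link : ∀ {a b} → Adjacent cs a b → end H (flip a) ≡ end H b
      adjacent-link = closedWalk-Adjacent H w
      merged∈cs : merged ∈ map (end H) cs
      merged∈cs = subst (_∈ map (end H) cs) c-at-merged (here refl)
      adjacent-at-merged : ∀ {a b} → Adjacent cs a b → end H b ≡ merged → b ≡ c × a ≡ l
      adjacent-at-merged ad q = Adjacent-head (end H) B uv ad (trans q (sym c-at-merged))
      start∈ : start ∈ map (end G) (map L cs)
      start∈ = here refl
      ∈-lift′ : ∀ {X v} → merge X ≡ v → v ∈ map (end H) cs → v ≢ merged → X ∈ map (end G) (map L cs)
      ∈-lift′ refl v∈ nv = ∈-lift v∈ nv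
      wrap-around : Adjacent cs l c
      wrap-around = wrap (proj₁ (∷-as-snoc c B)) B refl (proj₂ (∷-as-snoc c B))
      avoids-merged : ∀ {ds} → (∀ f → f ∈ ds → end H f ∉ map (end H) cs) → AvoidsMerged ds
      avoids-merged mid f f∈ q = mid f f∈ (subst (_∈ map (end H) cs) (sym q) merged∈cs)
      ¬at-rest : ∀ {t} → merge t ≡ merged → ∀ c₂ → c₂ ∈ B → t ≢ end G (L c₂)
      ¬at-rest ct c₂ c₂∈ q = rest-avoids-merged c₂ c₂∈ (trans (cong merge (sym q)) ct)

      module Closes (eq : start ≡ stop) where
        C′ = map L cs
        C′-cycle : IsCycle G C′
        C′-cycle = (λ ()) , (start , subst (λ t → IsWalk G start t (map L cs)) (sym eq) C′-walk) ,
            Unique-map-liftDart e {cs} ue , Unique-ends-lift {cs} uv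
        open Lift {cs} C′ C′-cycle (λ f → edges-off-lift {f} {cs}) (λ g nc q → nc (merge-∈ {cs = cs} q))
        adjacent-lift : ∀ {a b} → Adjacent cs a b → end H b ≢ merged → Adjacent C′ (L a) (L b)
        adjacent-lift ad _ = Adjacent-map L ad
        merged-∉ : ∀ t → merge t ≡ merged → t ≢ start → t ∉ map (end G) C′
        merged-∉ t ct ns t∈ with ∈-map⁻ (end G) t∈
        ... | g , g∈ , teq with ∈-map⁻ L g∈
        ... | c₂ , here refl , refl = ns teq
        ... | c₂ , there c₂∈ , refl = ¬at-rest ct c₂ c₂∈ teq
        e-off : ∀ (g : Dart (suc m)) → proj₁ g ≡ e → proj₁ g ∉ map proj₁ C′
        e-off g qe = edge-off-lift {g} cs qe
        edge-ends-≢ : ∀ β → end G (e , not β) ≢ end G (e , β)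
        edge-ends-≢ β q with edge-end-injective q
        edge-ends-≢ true q | ()
        edge-ends-≢ false q | ()

        lift-closing-away : (P : StrongWitness H cs) → source P ≢ merged → target P ≢ merged → StrongWitnessPair G
        lift-closing-away P@(sw x y d ds wlk upath xin yin disj mid lft rgt x≢y) x≢merged y≢merged =
          lift-path P (avoids-merged mid) (∈-lift′ (proj₁ wlk) xin x≢merged) (∈-lift′ y-end yin y≢merged)
            (LeftOf′-lift adjacent-lift lft (λ q → x≢merged (trans (sym (proj₁ wlk)) q)))
            (RightOf′-lift adjacent-lift adjacent-link rgt (λ q → y≢merged (trans (sym y-end) q)))
          where
          y-end = IsWalk-last H d ds wlk

        lift-closing-from-merged : (P : StrongWitness H cs) → source P ≡ merged → target P ≢ merged → StrongWitnessPair G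
        lift-closing-from-merged P@(sw x y d ds wlk upath xin yin disj mid (a , b , ad , eb , iv) rgt x≢y) x≡merged y≢merged
          with adjacent-at-merged ad (trans eb (trans (proj₁ wlk) x≡merged))
        ... | refl , refl with Interval-contract iv
        ... | inj₁ (e₁ , iv′) =
          lift-path P ds-avoids (subst (_∈ map (end G) C′) (sym e₁) start∈) y∈C′
            (L l , L c , Adjacent-map L wrap-around , sym e₁ , iv′) right′
          where
          ds-avoids = avoids-merged mid
          y-end = IsWalk-last H d ds wlk
          right′ = RightOf′-lift adjacent-lift adjacent-link rgt (λ q → y≢merged (trans (sym y-end) q))
          y∈C′ = ∈-lift′ y-end yin y≢merged
        ... | inj₂ (β , eβ , iv′ , ends′) =
          lift-path-prepend e-off β P ds-avoids (sym ends′)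
            (merged-∉ _ (trans (cong merge ends′) (OnEdge⇒merged (OnEdge-end (not β))))
                      (λ q → edge-ends-≢ β (trans (sym ends′) (trans q (sym eβ)))))
            (subst (_∈ map (end G) C′) (sym eβ) start∈) y∈C′
            (L l , L c , Adjacent-map L wrap-around , sym eβ , iv′) right′
            (λ q → y≢merged (trans (sym y-end) (trans (cong merge (sym q)) (OnEdge⇒merged (OnEdge-end β)))))
          where
          ds-avoids = avoids-merged mid
          y-end = IsWalk-last H d ds wlk
          right′ = RightOf′-lift adjacent-lift adjacent-link rgt (λ q → y≢merged (trans (sym y-end) q))
          y∈C′ = ∈-lift′ y-end yin y≢merged

        lift-closing-to-merged : (P : StrongWitness H cs) → source P ≢ merged → target P ≡ merged → StrongWitnessPair G
        lift-closing-to-merged P@(sw x y d ds wlk upath xin yin disj mid lft (a , b , ad , eb , iv) x≢y) x≢merged y≡merged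
          with adjacent-at-merged ad (trans eb (trans (IsWalk-last H d ds wlk) y≡merged))
        ... | refl , refl with Interval-contract iv
        ... | inj₁ (e₁ , iv′) =
          lift-path P (avoids-merged mid) x∈C′ (subst (_∈ map (end G) C′) (sym (trans e₁ (sym eq))) start∈)
            left′ (L l , L c , Adjacent-map L wrap-around , trans eq (sym e₁) , iv′)
          where
          left′ = LeftOf′-lift adjacent-lift lft (λ q → x≢merged (trans (sym (proj₁ wlk)) q))
          x∈C′ = ∈-lift′ (proj₁ wlk) xin x≢merged
        ... | inj₂ (β , eβ , iv′ , ends′) =
          lift-path-append e-off (not β) P (avoids-merged mid) ends′
            (merged-∉ _ (OnEdge⇒merged (OnEdge-end (not β))) (λ q → edge-ends-≢ β (trans q (trans eq (sym eβ)))))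
            x∈C′ (subst (_∈ map (end G) C′) (sym (trans (cong (λ t → end G (e , t)) (not-involutive β)) (trans eβ (sym eq)))) start∈)
            left′
            (L l , L c , Adjacent-map L wrap-around ,
             trans eq (trans (sym eβ) (cong (λ t → end G (e , t)) (sym (not-involutive β)))) ,
             subst (Interval G (flip (L l)) (L c)) (cong (e ,_) (sym (not-involutive β))) iv′)
            (λ q → x≢merged (trans (sym (proj₁ wlk)) (trans (cong merge q) (OnEdge⇒merged (OnEdge-end (not (not β)))))))
          where
          left′ = LeftOf′-lift adjacent-lift lft (λ q → x≢merged (trans (sym (proj₁ wlk)) q))
          x∈C′ = ∈-lift′ (proj₁ wlk) xin x≢merged

        lift-closing : StrongWitness H cs → StrongWitnessPair G
        lift-closing P with source P ≟ merged | target P ≟ merged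
        ... | yes x≡merged | yes y≡merged = ⊥-elim (source≢target P (trans x≡merged (sym y≡merged)))
        ... | no x≢merged | no y≢merged = lift-closing-away P x≢merged y≢merged
        ... | yes x≡merged | no y≢merged = lift-closing-from-merged P x≡merged y≢merged
        ... | no x≢merged | yes y≡merged = lift-closing-to-merged P x≢merged y≡merged

      module Opens (ne : start ≢ stop) where
        β′ = proj₁ (OnEdge⇒end stop-on-e)
        eβ′ : end G (e , β′) ≡ stop
        eβ′ = proj₂ (OnEdge⇒end stop-on-e)
        e-dart : Dart (suc m)
        e-dart = (e , β′)
        e-dart-other-end : end G (flip e-dart) ≡ start
        e-dart-other-end = edge-other-end e-dart refl start-on-e (λ q → ne (trans (sym q) eβ′))
        C′ = map L cs ++ [ e-dart ]
        e-dart-new : All (end G e-dart ≢_) (map (end G) (map L cs))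
        e-dart-new = All.tabulate tb
          where
          tb : ∀ {v} → v ∈ map (end G) (map L cs) → end G e-dart ≢ v
          tb v∈ q with ∈-map⁻ (end G) v∈
          ... | g , g∈ , refl with ∈-map⁻ L g∈
          ... | c₂ , here refl , refl = ne (trans (sym q) eβ′)
          ... | c₂ , there c₂∈ , refl = ¬at-rest (trans (cong merge eβ′) merge-stop) c₂ c₂∈ q
        C′-cycle : IsCycle G C′
        C′-cycle = (λ ()) ,
            (start , IsWalk-++ G (map L cs) ([ e-dart ]) C′-walk (eβ′ , e-dart-other-end)) ,
               Unique-insert-edge cs [] β′ (subst (λ t → Unique (map proj₁ t)) (sym (++-identityʳ cs)) ue) ,
               subst Unique (sym (map-++ (end G) (map L cs) ([ e-dart ])))
                   (Unique-snoc (Unique-ends-lift {cs} uv) e-dart-new)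
        merge-∈′ : ∀ {z} → z ∈ map (end G) C′ → merge z ∈ map (end H) cs
        merge-∈′ z∈ with ∈-map⁻ (end G) z∈
        ... | g , g∈ , refl with ∈-++⁻ (map L cs) g∈
        ... | inj₁ g∈₁ = merge-∈ {cs = cs} (∈-map⁺ (end G) g∈₁)
        ... | inj₂ (here refl) = subst (_∈ map (end H) cs) (sym (trans (cong merge eβ′) merge-stop)) merged∈cs
        open Lift {cs} C′ C′-cycle (λ f nf → edges-off-lift-++ {f} {cs} nf [ e-dart ] (refl ∷ [])) (λ g nc q → nc (merge-∈′ q))
        ∈-C′ : ∀ {X} → X ∈ map (end G) (map L cs) → X ∈ map (end G) C′
        ∈-C′ {X} X∈ = subst (X ∈_) (sym (map-++ (end G) (map L cs) ([ e-dart ]))) (∈-++⁺ˡ X∈)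
        stop∈ : end G e-dart ∈ map (end G) C′
        stop∈ = subst (end G e-dart ∈_) (sym (map-++ (end G) (map L cs) ([ e-dart ])))
            (∈-++⁺ʳ (map (end G) (map L cs)) (here refl))
        adjacent-lift : ∀ {a b} → Adjacent cs a b → end H b ≢ merged → Adjacent C′ (L a) (L b)
        adjacent-lift {a} {b} (inner xs ys eqa) _ =
          inner (map L xs) (map L ys ++ [ e-dart ])
                (trans (sym (++-assoc (map L xs) (L a ∷ L b ∷ map L ys) ([ e-dart ])))
                       (cong (_++ [ e-dart ]) (trans (sym (map-++ L xs (a ∷ b ∷ ys))) (cong (map L) eqa))))
        adjacent-lift (wrap xs ys e₁ _) nbw with ∷-injective e₁
        ... | refl , _ = ⊥-elim (nbw c-at-merged)
        wrap-around′ : Adjacent C′ e-dart (L c)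
        wrap-around′ = wrap (map L cs) (map L B ++ [ e-dart ]) refl refl
        into-e-dart : Adjacent C′ (L l) e-dart
        into-e-dart with ∷-as-snoc c B
        ... | P , eqP = inner (map L P) []
                (sym (trans (cong (λ t → map L t ++ [ e-dart ]) eqP) (trans (cong (_++ [ e-dart ]) (map-++ L P (l ∷ []))) (++-assoc (map L P) (L l ∷ []) ([ e-dart ])))))

        lift-opening-away : (P : StrongWitness H cs) → source P ≢ merged → target P ≢ merged → StrongWitnessPair G
        lift-opening-away P@(sw x y d ds wlk upath xin yin disj mid lft rgt x≢y) x≢merged y≢merged =
          lift-path P (avoids-merged mid) (∈-C′ (∈-lift′ (proj₁ wlk) xin x≢merged)) (∈-C′ (∈-lift′ y-end yin y≢merged))
            (LeftOf′-lift adjacent-lift lft (λ q → x≢merged (trans (sym (proj₁ wlk)) q)))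
            (RightOf′-lift adjacent-lift adjacent-link rgt (λ q → y≢merged (trans (sym y-end) q)))
          where
          y-end = IsWalk-last H d ds wlk

        lift-opening-from-merged : (P : StrongWitness H cs) → source P ≡ merged → target P ≢ merged → StrongWitnessPair G
        lift-opening-from-merged P@(sw x y d ds wlk upath xin yin disj mid (a , b , ad , eb , iv) rgt x≢y) x≡merged y≢merged
          with adjacent-at-merged ad (trans eb (trans (proj₁ wlk) x≡merged))
        ... | refl , refl with Interval-contract-merged (not β′) (sym e-dart-other-end)
                                 (trans (sym eβ′) (cong (λ t → end G (e , t)) (sym (not-involutive β′)))) iv
        ... | inj₁ (e₁ , iv′) =
          lift-path P (avoids-merged mid)
            (∈-C′ (subst (_∈ map (end G) (map L cs)) (sym (trans e₁ e-dart-other-end)) start∈)) y∈C′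
            (e-dart , L c , wrap-around′ , sym (trans e₁ e-dart-other-end) , iv′) right′
          where
          y-end = IsWalk-last H d ds wlk
          right′ = RightOf′-lift adjacent-lift adjacent-link rgt (λ q → y≢merged (trans (sym y-end) q))
          y∈C′ = ∈-C′ (∈-lift′ y-end yin y≢merged)
        ... | inj₂ (e₁ , iv′) =
          lift-path P (avoids-merged mid)
            (subst (_∈ map (end G) C′) (trans (cong (λ t → end G (e , t)) (sym (not-involutive β′))) (sym e₁)) stop∈) y∈C′
            (L l , e-dart , into-e-dart , trans (cong (λ t → end G (e , t)) (sym (not-involutive β′))) (sym e₁) ,
             subst (λ t → Interval G t (flip (L l)) (L d)) (cong (e ,_) (not-involutive β′)) iv′) right′
          where
          y-end = IsWalk-last H d ds wlk
          right′ = RightOf′-lift adjacent-lift adjacent-link rgt (λ q → y≢merged (trans (sym y-end) q))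
          y∈C′ = ∈-C′ (∈-lift′ y-end yin y≢merged)

        lift-opening-to-merged : (P : StrongWitness H cs) → source P ≢ merged → target P ≡ merged → StrongWitnessPair G
        lift-opening-to-merged P@(sw x y d ds wlk upath xin yin disj mid lft (a , b , ad , eb , iv) x≢y) x≢merged y≡merged
          with adjacent-at-merged ad (trans eb (trans (IsWalk-last H d ds wlk) y≡merged))
        ... | refl , refl with Interval-contract-merged β′ (sym eβ′) (sym e-dart-other-end) iv
        ... | inj₁ (e₁ , iv′) =
          lift-path P (avoids-merged mid) x∈C′ (subst (_∈ map (end G) C′) (sym e₁) stop∈)
            left′ (L l , e-dart , into-e-dart , sym e₁ , iv′)
          where
          left′ = LeftOf′-lift adjacent-lift lft (λ q → x≢merged (trans (sym (proj₁ wlk)) q))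
          x∈C′ = ∈-C′ (∈-lift′ (proj₁ wlk) xin x≢merged)
        ... | inj₂ (e₁ , iv′) =
          lift-path P (avoids-merged mid) x∈C′
            (∈-C′ (subst (_∈ map (end G) (map L cs)) (sym (trans e₁ e-dart-other-end)) start∈))
            left′ (e-dart , L c , wrap-around′ , sym (trans e₁ e-dart-other-end) , iv′)
          where
          left′ = LeftOf′-lift adjacent-lift lft (λ q → x≢merged (trans (sym (proj₁ wlk)) q))
          x∈C′ = ∈-C′ (∈-lift′ (proj₁ wlk) xin x≢merged)

        lift-opening : StrongWitness H cs → StrongWitnessPair G
        lift-opening P with source P ≟ merged | target P ≟ merged
        ... | yes x≡merged | yes y≡merged = ⊥-elim (source≢target P (trans x≡merged (sym y≡merged)))
        ... | no x≢merged | no y≢merged = lift-opening-away P x≢merged y≢merged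
        ... | yes x≡merged | no y≢merged = lift-opening-from-merged P x≡merged y≢merged
        ... | no x≢merged | yes y≡merged = lift-opening-to-merged P x≢merged y≡merged

    lift-cycle-through-merged : ∀ c B → IsCycle H (c ∷ B) → end H c ≡ merged → StrongWitness H (c ∷ B) → StrongWitnessPair G
    lift-cycle-through-merged c B cyc c-at-merged P with end G (L c) ≟ CycleThroughMerged.stop c B cyc c-at-merged
    ... | yes closes = CycleThroughMerged.Closes.lift-closing c B cyc c-at-merged closes P
    ... | no opens = CycleThroughMerged.Opens.lift-opening c B cyc c-at-merged opens P

    contract-StrongWitnessPair : StrongWitnessPair H → StrongWitnessPair G
    contract-StrongWitnessPair (cs , cyc , P) with merged ∈? map (end H) cs
    ... | no merged∉ with StrongWitness-shortcut H merged P
    ... | P′ , inj₁ avoids = CycleAvoidsMerged.lift-avoiding cyc merged∉ P′ avoids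
    ... | P′ , inj₂ (A , q , D , eq , A-avoids , D-avoids , q-at-merged) =
      CycleAvoidsMerged.lift-through-merged cyc merged∉ P′ A q D eq A-avoids D-avoids q-at-merged
    contract-StrongWitnessPair (cs , cyc , P) | yes merged∈ with ∈-map⁻ (end H) merged∈
    ... | c , c∈ , eqc with StrongWitnessPair-startAt H cyc P c∈
    ... | (_ , cyc′ , P′) , B , refl = lift-cycle-through-merged c B cyc′ (sym eqc) P′

Minor-StrongWitnessPair : ∀ {n m n′ m′} {G : RData n m} {H : RData n′ m′} →
                          Minor G H → IsWeakRibbon G → StrongWitnessPair H → StrongWitnessPair G
Minor-StrongWitnessPair done wr s = s
Minor-StrongWitnessPair {G = G} (del e minor) wr s =
  Deletion.delete-StrongWitnessPair G e
    (Minor-StrongWitnessPair minor (Deletion.delete-IsWeakRibbon G e wr) s)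
Minor-StrongWitnessPair {G = G} (con e nl minor) wr s =
  Contraction.contract-StrongWitnessPair G e nl wr
    (Minor-StrongWitnessPair minor (Contraction.contract-IsWeakRibbon G e nl wr) s)
Minor-StrongWitnessPair {G = G} (delV w iso minor) wr s =
  VertexRemoval.removeVertex-StrongWitnessPair G w iso
    (Minor-StrongWitnessPair minor (VertexRemoval.removeVertex-IsWeakRibbon G w iso wr) s)

proposition3p4 : ∀ {n m} (G : RData n m) → IsRibbon G → Loopless G → Connected G →
                 (∃ λ m' → ∃ λ (H : RData 4 m') → Minor G H × IsK4 H × Nonplanar H) →
                 ProperWitnessPair G
proposition3p4 G ribbon _ _ (_ , H , minor , k4 , nonplanar) =
  StrongWitnessPair⇒ProperWitnessPair
    (Minor-StrongWitnessPair minor (IsRibbon⇒IsWeakRibbon ribbon)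
      (K4-Nonplanar⇒StrongWitnessPair H k4 nonplanar))
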